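{- Let $N_1, N_2, N^l_1, N^l_2, N^r_1, N^r_2$ be nets, let $a$ be an action and let $R \subseteq Act \times Act$. If $N_1 \mathrel{\leftrightarrow_{sp}} N_2$, then $a_{\mathcal N} N_1 \mathrel{\leftrightarrow_{sp}} a_{\mathcal N} N_2$ and $R_{\mathcal N}(N_1) \mathrel{\leftrightarrow_{sp}} R_{\mathcal N}(N_2)$. If $N^l_1 \mathrel{\leftrightarrow_{sp}} N^l_2$ and $N^r_1 \mathrel{\leftrightarrow_{sp}} N^r_2$, then $N^l_1 \parallel_{\mathcal N} N^r_1 \mathrel{\leftrightarrow_{sp}} N^l_2 \parallel_{\mathcal N} N^r_2$, and, if moreover the initial markings of $N^l_i$ and $N^r_i$ ($i=1,2$) are nonempty plain sets, $N^l_1 +_{\mathcal N} N^r_1 \mathrel{\leftrightarrow_{sp}} N^l_2 +_{\mathcal N} N^r_2$.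
   Context: $Act$ is a fixed infinite set of actions. A multiset over a set $X$ is a function $X\to\mathbb N$; $\le$, $+$, $-$ (when defined) and $\cap$ (pointwise minimum) are taken pointwise, and a multiset with all values $\le 1$ is identified with a plain set. A (typed) Petri net is a tuple $N=(S,T,F,M_0,A,\ell)$ with $S,T$ disjoint sets of places and transitions, $F:(S\times T)\cup(T\times S)\to\mathbb N$, initial marking $M_0\in\mathbb N^S$, a set $A\subseteq Act$ (the type) and a labelling $\ell:T\to A$. For $x\in S\cup T$, ${}^\bullet x(y)=F(y,x)$ and $x^\bullet(y)=F(x,y)$. A transition $t$ is enabled at a marking $M\in\mathbb N^S$ if ${}^\bullet t\le M$, and firing it yields $M-{}^\bullet t+t^\bullet$. A marking is reachable if it is obtained from $M_0$ by a finite sequence of firings. A Petri net has bounded parallelism if there is no reachable marking $M$ and multiset $U$ of transitions with infinitely many elements (counted with multiplicity) such that $\sum_{t\in U}{}^\bullet t\le M$. A "net" is a Petri net with bounded parallelism. Structure preserving bisimilarity: for nets $N_i=(S_i,T_i,F_i,M_i,A_i,\ell_i)$, $i=1,2$, a linking is a multiset $l\in\mathbb N^{S_1\times S_2}$; its projections are $\pi_1(l)(s_1)=\sum_{s_2\in S_2}l(s_1,s_2)$ and $\pi_2(l)(s_2)=\sum_{s_1\in S_1}l(s_1,s_2)$. An sp-bisimulation is a set $\mathcal B$ of linkings such that (i) whenever $c\le l\in\mathcal B$ and $\pi_1(c)={}^\bullet t_1$ for some $t_1\in T_1$, there are $t_2\in T_2$ with $\ell_2(t_2)=\ell_1(t_1)$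 and $\pi_2(c)={}^\bullet t_2$, and a linking $\bar c$ with $\pi_1(\bar c)=t_1^\bullet$, $\pi_2(\bar c)=t_2^\bullet$ and $l-c+\bar c\in\mathcal B$; (ii) symmetrically, whenever $c\le l\in\mathcal B$ and $\pi_2(c)={}^\bullet t_2$ for some $t_2\in T_2$, there are $t_1\in T_1$ and $\bar c$ with the same properties. $N_1\mathrel{\leftrightarrow_{sp}}N_2$ iff $A_1=A_2$ and some sp-bisimulation contains a linking $l$ with $\pi_1(l)=M_1$ and $\pi_2(l)=M_2$. Net operators (defined up to isomorphism): For $N=(S,T,F,M,A,\ell)$ and $a\in Act$, $a_{\mathcal N}N$ is obtained from $N$ by adding a fresh place $s_0$ and a fresh transition $t_a$ labelled $a$ with ${}^\bullet t_a=\{s_0\}$ and $t_a^\bullet=M$; its type is $A\cup\{a\}$ and its initial marking $\{s_0\}$. For $R\subseteq Act\times Act$, $R_{\mathcal N}(N)$ has type $\{b\mid \exists a\in A,(a,b)\in R\}$, the same places and initial marking as $N$, and a transition $t_b$ for each $t\in T$ and $b$ with $(\ell(t),b)\in R$, with ${}^\bullet t_b={}^\bullet t$, $t_b^\bullet=t^\bullet$ and label $b$. For $N_i=(S_i,T_i,F_i,M_i,A_i,\ell_i)$ ($i=1,2$), $N_1\parallel_{\mathcal N}N_2$ has type $A_1\cup A_2$ and is obtained from the disjoint union of $N_1$ and $N_2$ (initial marking $M_1+M_2$) by omitting all transitions whose label lies in $A_1\cap A_2$ and adding fresh transitions $(t_1,t_2)$ for all $t_i\in T_i$ with $\ell_1(t_1)=\ell_2(t_2)\in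 A_1\cap A_2$, with ${}^\bullet(t_1,t_2)={}^\bullet t_1+{}^\bullet t_2$, $(t_1,t_2)^\bullet=t_1^\bullet+t_2^\bullet$, label $\ell_1(t_1)$. If $M_1,M_2$ are nonempty plain sets, $N_1+_{\mathcal N}N_2$ has type $A_1\cup A_2$ and is obtained from the disjoint union of $N_1$ and $N_2$ by adding the set of fresh places $M_1\times M_2$, which is the initial marking of $N_1+_{\mathcal N}N_2$, and fresh transitions $t_i^K$ for every $t_i\in T_i$ and $\emptyset\ne K\le {}^\bullet t_i\cap M_i$, with label $\ell_i(t_i)$, ${}^\bullet t_1^K={}^\bullet t_1-K+(K\times M_2)$, ${}^\bullet t_2^K={}^\bullet t_2-K+(M_1\times K)$, and $(t_i^K)^\bullet=t_i^\bullet$. -}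

module Defs where

open import Level using (Level)
open import Data.Nat using (ℕ; zero; suc; _+_; _*_; _∸_; _≤_; _⊓_)
open import Data.List using (List; map)
open import Data.Nat.ListAction using (sum)
open import Data.List.Membership.Propositional using (_∈_; _∉_)
open import Data.List.Relation.Unary.Unique.Propositional using (Unique)
open import Data.Product using (Σ; _×_; _,_; proj₁; proj₂; ∃)
open import Data.Sum using (_⊎_; inj₁; inj₂)
open import Data.Unit using (⊤; tt)
open import Data.Empty using (⊥)
open import Relation.Nullary using (¬_)
open import Relation.Binary.PropositionalEquality using (_≡_; _≢_)
open import Function.Bundles using (_⇔_)

Multiset : Set → Set
Multiset X = X → ℕ

_≤ᴹ_ : {X : Set} → Multiset X → Multiset X → Set
m ≤ᴹ n = ∀ x → m x ≤ n x

InfiniteSet : Set → Set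
InfiniteSet X = ¬ (Σ (List X) λ xs → ∀ x → x ∈ xs)

InfiniteMultiset : {X : Set} → Multiset X → Set
InfiniteMultiset {X} U = ¬ (Σ (List X) λ xs → ∀ x → U x ≢ 0 → x ∈ xs)

-- (Possibly infinite) sums of natural numbers over a type.
-- HasSum f n : the sum Σ_x f x exists (f has finite support) and equals n.
HasSum : {X : Set} → (X → ℕ) → ℕ → Set
HasSum {X} f n =
  Σ (List X) λ xs → Unique xs × (∀ x → x ∉ xs → f x ≡ 0) × (sum (map f xs) ≡ n)

-- SumLE f m : the (possibly infinite) sum Σ_x f x is ≤ m, i.e. every
-- finite partial sum over distinct elements is ≤ m.
SumLE : {X : Set} → (X → ℕ) → ℕ → Set
SumLE {X} f m = (xs : List X) → Unique xs → sum (map f xs) ≤ m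

-- Typed Petri nets. The flow relation F is given by presets ("pre t s =
-- F(s,t)") and postsets ("post t s = F(t,s)"). The type A ⊆ Act is a
-- predicate; the labelling lands in A.

record PNet (Act : Set) : Set₁ where
  field
    S    : Set
    T    : Set
    pre  : T → Multiset S
    post : T → Multiset S
    M₀   : Multiset S
    A    : Act → Set
    ℓ    : T → Act
    ℓ∈A  : ∀ t → A (ℓ t)

module _ {Act : Set} (N : PNet Act) where
  open PNet N

  Enabled : T → Multiset S → Set
  Enabled t M = pre t ≤ᴹ M

  fire : T → Multiset S → Multiset S
  fire t M s = M s ∸ pre t s + post t s

  data Reachable : Multiset S → Set where
    init : Reachable M₀
    step : ∀ {M} → Reachable M → (t : T) → Enabled t M → Reachable (fire t M)

  BoundedParallelism : Set
  BoundedParallelism =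
    ¬ (Σ (Multiset S) λ M → Reachable M ×
         Σ (Multiset T) λ U → InfiniteMultiset U ×
           (∀ s → SumLE (λ t → U t * pre t s) (M s)))

  PlainNonemptyInit : Set
  PlainNonemptyInit = (∀ s → M₀ s ≤ 1) × (Σ S λ s → M₀ s ≢ 0)

module _ {Act : Set} (N₁ N₂ : PNet Act) where
  private
    module N₁ = PNet N₁
    module N₂ = PNet N₂

  Linking : Set
  Linking = N₁.S → N₂.S → ℕ

  _≤ᴸ_ : Linking → Linking → Set
  c ≤ᴸ l = ∀ s₁ s₂ → c s₁ s₂ ≤ l s₁ s₂

  π₁≡ : Linking → Multiset N₁.S → Set
  π₁≡ l M = ∀ s₁ → HasSum (λ s₂ → l s₁ s₂) (M s₁)

  π₂≡ : Linking → Multiset N₂.S → Set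
  π₂≡ l M = ∀ s₂ → HasSum (λ s₁ → l s₁ s₂) (M s₂)

  -- l - c + c̄ (used only when c ≤ l)
  update : Linking → Linking → Linking → Linking
  update l c c̄ s₁ s₂ = l s₁ s₂ ∸ c s₁ s₂ + c̄ s₁ s₂

  IsSPBisimulation : (Linking → Set) → Set
  IsSPBisimulation 𝓑 =
    (∀ l c (t₁ : N₁.T) → 𝓑 l → c ≤ᴸ l → π₁≡ c (N₁.pre t₁) →
       Σ N₂.T λ t₂ → N₂.ℓ t₂ ≡ N₁.ℓ t₁ × π₂≡ c (N₂.pre t₂) ×
         Σ Linking λ c̄ → π₁≡ c̄ (N₁.post t₁) × π₂≡ c̄ (N₂.post t₂) ×
           𝓑 (update l c c̄))
    ×
    (∀ l c (t₂ : N₂.T) → 𝓑 l → c ≤ᴸ l → π₂≡ c (N₂.pre t₂) →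
       Σ N₁.T λ t₁ → N₁.ℓ t₁ ≡ N₂.ℓ t₂ × π₁≡ c (N₁.pre t₁) ×
         Σ Linking λ c̄ → π₁≡ c̄ (N₁.post t₁) × π₂≡ c̄ (N₂.post t₂) ×
           𝓑 (update l c c̄))

  _↔sp_ : Set₁
  _↔sp_ =
    (∀ a → N₁.A a ⇔ N₂.A a) ×
    Σ (Linking → Set) λ 𝓑 → IsSPBisimulation 𝓑 ×
      Σ Linking λ l → 𝓑 l × π₁≡ l N₁.M₀ × π₂≡ l N₂.M₀

-- Net operators (concrete representatives of the isomorphism classes)

-- action prefix a_𝒩 N : fresh place inj₁ tt, fresh transition inj₁ tt
prefixᴺ : {Act : Set} → Act → PNet Act → PNet Act
prefixᴺ {Act} a N = record
  { S    = ⊤ ⊎ S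
  ; T    = ⊤ ⊎ T
  ; pre  = λ { (inj₁ _) (inj₁ _) → 1 ; (inj₁ _) (inj₂ _) → 0
             ; (inj₂ t) (inj₁ _) → 0 ; (inj₂ t) (inj₂ s) → pre t s }
  ; post = λ { (inj₁ _) (inj₁ _) → 0 ; (inj₁ _) (inj₂ s) → M₀ s
             ; (inj₂ t) (inj₁ _) → 0 ; (inj₂ t) (inj₂ s) → post t s }
  ; M₀   = λ { (inj₁ _) → 1 ; (inj₂ _) → 0 }
  ; A    = λ b → A b ⊎ b ≡ a
  ; ℓ    = λ { (inj₁ _) → a ; (inj₂ t) → ℓ t }
  ; ℓ∈A  = λ { (inj₁ _) → inj₂ _≡_.refl ; (inj₂ t) → inj₁ (ℓ∈A t) }
  }
  where open PNet N

relabelᴺ : {Act : Set} → (Act → Act → Set) → PNet Act → PNet Act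
relabelᴺ {Act} R N = record
  { S    = S
  ; T    = Σ T λ t → Σ Act λ b → R (ℓ t) b
  ; pre  = λ u → pre (proj₁ u)
  ; post = λ u → post (proj₁ u)
  ; M₀   = M₀
  ; A    = λ b → Σ Act λ a → A a × R a b
  ; ℓ    = λ u → proj₁ (proj₂ u)
  ; ℓ∈A  = λ u → ℓ (proj₁ u) , ℓ∈A (proj₁ u) , proj₂ (proj₂ u)
  }
  where open PNet N

parᴺ : {Act : Set} → PNet Act → PNet Act → PNet Act
parᴺ {Act} N₁ N₂ = record
  { S    = N₁.S ⊎ N₂.S
  ; T    = (Σ N₁.T λ t → ¬ N₂.A (N₁.ℓ t))     -- label not in A₁ ∩ A₂
         ⊎ (Σ N₂.T λ t → ¬ N₁.A (N₂.ℓ t))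
         ⊎ (Σ (N₁.T × N₂.T) λ p → N₁.ℓ (proj₁ p) ≡ N₂.ℓ (proj₂ p))
  ; pre  = λ { (inj₁ (t , _)) (inj₁ s) → N₁.pre t s
             ; (inj₁ (t , _)) (inj₂ s) → 0
             ; (inj₂ (inj₁ (t , _))) (inj₁ s) → 0
             ; (inj₂ (inj₁ (t , _))) (inj₂ s) → N₂.pre t s
             ; (inj₂ (inj₂ ((t₁ , t₂) , _))) (inj₁ s) → N₁.pre t₁ s
             ; (inj₂ (inj₂ ((t₁ , t₂) , _))) (inj₂ s) → N₂.pre t₂ s }
  ; post = λ { (inj₁ (t , _)) (inj₁ s) → N₁.post t s
             ; (inj₁ (t , _)) (inj₂ s) → 0
             ; (inj₂ (inj₁ (t , _))) (inj₁ s) → 0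
             ; (inj₂ (inj₁ (t , _))) (inj₂ s) → N₂.post t s
             ; (inj₂ (inj₂ ((t₁ , t₂) , _))) (inj₁ s) → N₁.post t₁ s
             ; (inj₂ (inj₂ ((t₁ , t₂) , _))) (inj₂ s) → N₂.post t₂ s }
  ; M₀   = λ { (inj₁ s) → N₁.M₀ s ; (inj₂ s) → N₂.M₀ s }
  ; A    = λ a → N₁.A a ⊎ N₂.A a
  ; ℓ    = λ { (inj₁ (t , _)) → N₁.ℓ t
             ; (inj₂ (inj₁ (t , _))) → N₂.ℓ t
             ; (inj₂ (inj₂ ((t₁ , t₂) , _))) → N₁.ℓ t₁ }
  ; ℓ∈A  = λ { (inj₁ (t , _)) → inj₁ (N₁.ℓ∈A t)
             ; (inj₂ (inj₁ (t , _))) → inj₂ (N₂.ℓ∈A t)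
             ; (inj₂ (inj₂ ((t₁ , t₂) , _))) → inj₁ (N₁.ℓ∈A t₁) }
  }
  where
    module N₁ = PNet N₁
    module N₂ = PNet N₂

-- choice N₁ +_𝒩 N₂ (meaningful when the initial markings are nonempty
-- plain sets). Fresh places: M₁ × M₂, i.e. pairs of initially marked places.
-- Fresh transitions t^K for nonempty K ≤ •t ∩ Mᵢ.
module _ {Act : Set} (N₁ N₂ : PNet Act) where
  private
    module N₁ = PNet N₁
    module N₂ = PNet N₂

  ChoicePlace : Set
  ChoicePlace = Σ (N₁.S × N₂.S) λ p → (1 ≤ N₁.M₀ (proj₁ p)) × (1 ≤ N₂.M₀ (proj₂ p))

  GoodK₁ : N₁.T → Multiset N₁.S → Set
  GoodK₁ t K = (∀ s → K s ≤ N₁.pre t s ⊓ N₁.M₀ s) × (Σ N₁.S λ s → K s ≢ 0)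

  GoodK₂ : N₂.T → Multiset N₂.S → Set
  GoodK₂ t K = (∀ s → K s ≤ N₂.pre t s ⊓ N₂.M₀ s) × (Σ N₂.S λ s → K s ≢ 0)

  choiceᴺ : PNet Act
  choiceᴺ = record
    { S    = N₁.S ⊎ N₂.S ⊎ ChoicePlace
    ; T    = N₁.T ⊎ N₂.T
           ⊎ (Σ N₁.T λ t → Σ (Multiset N₁.S) λ K → GoodK₁ t K)
           ⊎ (Σ N₂.T λ t → Σ (Multiset N₂.S) λ K → GoodK₂ t K)
    ; pre  = pre'
    ; post = post'
    ; M₀   = λ { (inj₁ _) → 0 ; (inj₂ (inj₁ _)) → 0 ; (inj₂ (inj₂ _)) → 1 }
    ; A    = λ a → N₁.A a ⊎ N₂.A a
    ; ℓ    = λ { (inj₁ t) → N₁.ℓ t ; (inj₂ (inj₁ t)) → N₂.ℓ t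
               ; (inj₂ (inj₂ (inj₁ (t , _)))) → N₁.ℓ t
               ; (inj₂ (inj₂ (inj₂ (t , _)))) → N₂.ℓ t }
    ; ℓ∈A  = λ { (inj₁ t) → inj₁ (N₁.ℓ∈A t) ; (inj₂ (inj₁ t)) → inj₂ (N₂.ℓ∈A t)
               ; (inj₂ (inj₂ (inj₁ (t , _)))) → inj₁ (N₁.ℓ∈A t)
               ; (inj₂ (inj₂ (inj₂ (t , _)))) → inj₂ (N₂.ℓ∈A t) }
    }
    where
      TT = N₁.T ⊎ N₂.T
           ⊎ (Σ N₁.T λ t → Σ (Multiset N₁.S) λ K → GoodK₁ t K)
           ⊎ (Σ N₂.T λ t → Σ (Multiset N₂.S) λ K → GoodK₂ t K)
      SS = N₁.S ⊎ N₂.S ⊎ ChoicePlace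
      pre' : TT → SS → ℕ
      pre' (inj₁ t) (inj₁ s) = N₁.pre t s
      pre' (inj₁ t) (inj₂ _) = 0
      pre' (inj₂ (inj₁ t)) (inj₂ (inj₁ s)) = N₂.pre t s
      pre' (inj₂ (inj₁ t)) _ = 0
      -- •t₁^K = •t₁ - K + (K × M₂)
      pre' (inj₂ (inj₂ (inj₁ (t , K , _)))) (inj₁ s) = N₁.pre t s ∸ K s
      pre' (inj₂ (inj₂ (inj₁ (t , K , _)))) (inj₂ (inj₁ s)) = 0
      pre' (inj₂ (inj₂ (inj₁ (t , K , _)))) (inj₂ (inj₂ ((s₁ , s₂) , _))) = K s₁ * N₂.M₀ s₂
      -- •t₂^K = •t₂ - K + (M₁ × K)
      pre' (inj₂ (inj₂ (inj₂ (t , K , _)))) (inj₁ s) = 0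
      pre' (inj₂ (inj₂ (inj₂ (t , K , _)))) (inj₂ (inj₁ s)) = N₂.pre t s ∸ K s
      pre' (inj₂ (inj₂ (inj₂ (t , K , _)))) (inj₂ (inj₂ ((s₁ , s₂) , _))) = N₁.M₀ s₁ * K s₂
      post' : TT → SS → ℕ
      post' (inj₁ t) (inj₁ s) = N₁.post t s
      post' (inj₁ t) (inj₂ _) = 0
      post' (inj₂ (inj₁ t)) (inj₂ (inj₁ s)) = N₂.post t s
      post' (inj₂ (inj₁ t)) _ = 0
      post' (inj₂ (inj₂ (inj₁ (t , _)))) (inj₁ s) = N₁.post t s
      post' (inj₂ (inj₂ (inj₁ (t , _)))) (inj₂ _) = 0
      post' (inj₂ (inj₂ (inj₂ (t , _)))) (inj₂ (inj₁ s)) = N₂.post t s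
      post' (inj₂ (inj₂ (inj₂ (t , _)))) _ = 0

-- Each operator preserves ↔sp because sp-bisimulations of the components can be
-- assembled into an explicit sp-bisimulation of the composed nets; all constructions
-- are symmetric under swapping the two sides, so only the forward transfer property
-- needs checking. Relabelling keeps the bisimulation, and parallel composition takes
-- block-diagonal linkings. For a prefix, the token on the fresh place stands for a
-- reserved copy of the initial linking, released when the prefix fires. For a choice,
-- the initial tokens sit on the pairs M₁ × M₂, linked by the product of the two
-- initial linkings; a component linking is its actual part plus the part of its
-- initial linking still held in reserve on these pairs. A transition t^K consumes the
-- rows of the pairs over K completely and is answered by t₂^K′, where K′ consists of
-- the places linked to K by the initial linking.
module Submission where

open import Data.Empty using (⊥; ⊥-elim)
open import Data.List using (List; []; _∷_; _++_; map; filter; cartesianProduct)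
open import Data.List.Membership.Propositional using (_∈_; _∉_)
open import Data.List.Membership.Propositional.Properties
  using (∈-++⁺ˡ; ∈-++⁺ʳ; ∈-filter⁺; ∈-filter⁻; ∈-map⁺; ∈-∃++; ∈-cartesianProduct⁺)
open import Data.List.Properties using (map-++; map-cong; map-∘)
open import Data.List.Relation.Binary.Permutation.Propositional using (_↭_; ↭-sym; ↭⇒↭ₛ)
open import Data.List.Relation.Binary.Permutation.Propositional.Properties
  using (shift; ∈-resp-↭) renaming (map⁺ to ↭-map⁺)
import Data.List.Relation.Binary.Permutation.Setoid.Properties as PermutationSetoid
import Data.List.Relation.Unary.All as All
open import Data.List.Relation.Unary.Any using (here; there)
open import Data.List.Relation.Unary.Unique.Propositional using (Unique; []; _∷_)
open import Data.List.Relation.Unary.Unique.Propositional.Properties as Unique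
  using (Unique[x∷xs]⇒x∉xs)
open import Data.Nat using (ℕ; zero; suc; _+_; _*_; _∸_; _≤_; _⊓_; z≤n; s≤s; _≟_; _≤?_; ≢-nonZero)
open import Data.Nat.ListAction using (sum)
open import Data.Nat.ListAction.Properties using (sum-++; sum-↭)
open import Data.Nat.Properties
open import Algebra.Properties.CommutativeSemigroup +-commutativeSemigroup using (interchange; xy∙z≈xz∙y)
open import Data.Product using (Σ; ∃; _×_; _,_; proj₁; proj₂)
open import Data.Sum using (_⊎_; inj₁; inj₂) renaming (map to ⊎-map)
open import Data.Unit using (⊤; tt)
open import Function using (_∘_)
open import Function.Bundles using (mk⇔; Equivalence)
open import Relation.Binary.PropositionalEquality
open import Relation.Binary.PropositionalEquality.Properties using (setoid)
open import Relation.Nullary using (Dec; yes; no; ¬?)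
open import Relation.Nullary.Decidable using (decidable-stable; ¬¬-excluded-middle; _×-dec_)

open import Defs

private variable
  X Y X₁ X₂ Y₁ Y₂ : Set
  f g : X → ℕ
  m n : ℕ

∸-+-interchange : ∀ {a b c d} → b ≤ a → d ≤ c → (a ∸ b) + (c ∸ d) ≡ (a + c) ∸ (b + d)
∸-+-interchange {a} {b} {c} {d} b≤a d≤c = begin
  (a ∸ b) + (c ∸ d) ≡⟨ +-∸-assoc (a ∸ b) d≤c ⟨
  (a ∸ b) + c ∸ d   ≡⟨ cong (_∸ d) (+-∸-comm c b≤a) ⟨
  a + c ∸ b ∸ d     ≡⟨ ∸-+-assoc (a + c) b d ⟩
  a + c ∸ (b + d)   ∎
  where open ≡-Reasoning

≤-≡0 : ∀ {m n} → m ≤ n → n ≡ 0 → m ≡ 0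
≤-≡0 m≤n refl = n≤0⇒n≡0 m≤n

∸-+0-≡0 : ∀ {l} c → l ≡ 0 → l ∸ c + 0 ≡ 0
∸-+0-≡0 c refl = cong (_+ 0) (0∸n≡0 c)

∸-+-+-comm : ∀ {l c} d i → c ≤ l → (l ∸ c + d) + i ≡ (l + i) ∸ c + d
∸-+-+-comm {l} {c} d i c≤l = trans (xy∙z≈xz∙y (l ∸ c) d i) (cong (_+ d) (sym (+-∸-comm i c≤l)))

≤1⇒≡0⊎≡1 : n ≤ 1 → n ≡ 0 ⊎ n ≡ 1
≤1⇒≡0⊎≡1 z≤n       = inj₁ refl
≤1⇒≡0⊎≡1 (s≤s z≤n) = inj₂ refl

*-≢0ˡ : ∀ {m n} → m * n ≢ 0 → m ≢ 0
*-≢0ˡ m*n≢0 refl = m*n≢0 refl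

*-≢0ʳ : ∀ m {n} → m * n ≢ 0 → n ≢ 0
*-≢0ʳ m m*n≢0 refl = m*n≢0 (*-zeroʳ m)

≢0-≤ : ∀ {m n} → m ≢ 0 → m ≤ n → 1 ≤ n
≢0-≤ m≢0 m≤n = ≤-trans (n≢0⇒n>0 m≢0) m≤n

consume-factorˡ : ∀ {v m i X} k → k ≤ 1 → (k ≡ 1 → m ≡ 1) → v ≡ (m * i) * X → v ∸ k * v + 0 ≡ ((m ∸ k) * i) * X
consume-factorˡ zero           _         _    v≡ = trans (+-identityʳ _) v≡
consume-factorˡ {v} (suc zero) _         m≡1 v≡ rewrite m≡1 refl | +-identityʳ v | n∸n≡0 v = refl
consume-factorˡ (suc (suc _))  (s≤s ()) _    _

consume-factorʳ : ∀ {v m i X} k → k ≤ 1 → (k ≡ 1 → m ≡ 1) → v ≡ X * (m * i) → v ∸ k * v + 0 ≡ X * ((m ∸ k) * i)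
consume-factorʳ {m = m} {i} {X} k k≤1 m≡1 v≡ =
  trans (consume-factorˡ k k≤1 m≡1 (trans v≡ (*-comm X (m * i)))) (*-comm ((m ∸ k) * i) X)

*-flagsˡ : ∀ {k m m′} i j → k ≤ 1 → (k ≡ 1 → m ≡ 1 × m′ ≡ 1) → k * ((m * i) * (m′ * j)) ≡ (k * i) * j
*-flagsˡ i j z≤n       _     = refl
*-flagsˡ i j (s≤s z≤n) flags with refl , refl ← flags refl =
  trans (*-identityˡ ((1 * i) * (1 * j))) (cong ((1 * i) *_) (*-identityˡ j))

*-flagsʳ : ∀ {k m m′} i j → k ≤ 1 → (k ≡ 1 → m ≡ 1 × m′ ≡ 1) → k * ((m * i) * (m′ * j)) ≡ i * (k * j)
*-flagsʳ i j z≤n       _     = sym (*-zeroʳ i)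
*-flagsʳ i j (s≤s z≤n) flags with refl , refl ← flags refl =
  trans (*-identityˡ ((1 * i) * (1 * j))) (cong (_* (1 * j)) (*-identityˡ i))

sumMap : (X → ℕ) → List X → ℕ
sumMap f xs = sum (map f xs)

VanishesOutside : (X → ℕ) → List X → Set
VanishesOutside f xs = ∀ x → x ∉ xs → f x ≡ 0

sumMap-++ : ∀ (f : X → ℕ) xs ys → sumMap f (xs ++ ys) ≡ sumMap f xs + sumMap f ys
sumMap-++ f xs ys = trans (cong sum (map-++ f xs ys)) (sum-++ (map f xs) (map f ys))

sumMap-↭ : ∀ (f : X → ℕ) {xs ys} → xs ↭ ys → sumMap f xs ≡ sumMap f ys
sumMap-↭ f p = sum-↭ (↭-map⁺ f p)

sumMap-+ : ∀ (f g : X → ℕ) xs → sumMap (λ x → f x + g x) xs ≡ sumMap f xs + sumMap g xs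
sumMap-+ f g []       = refl
sumMap-+ f g (x ∷ xs) = trans (cong (f x + g x +_) (sumMap-+ f g xs)) (interchange (f x) (g x) _ _)

sumMap-*ˡ : ∀ k (f : X → ℕ) xs → sumMap (λ x → k * f x) xs ≡ k * sumMap f xs
sumMap-*ˡ k f []       = sym (*-zeroʳ k)
sumMap-*ˡ k f (x ∷ xs) = trans (cong (k * f x +_) (sumMap-*ˡ k f xs)) (sym (*-distribˡ-+ k (f x) _))

sumMap-mono : (∀ x → f x ≤ g x) → ∀ xs → sumMap f xs ≤ sumMap g xs
sumMap-mono f≤g []       = z≤n
sumMap-mono f≤g (x ∷ xs) = +-mono-≤ (f≤g x) (sumMap-mono f≤g xs)

sumMap-∸ : (∀ x → g x ≤ f x) → ∀ xs → sumMap (λ x → f x ∸ g x) xs ≡ sumMap f xs ∸ sumMap g xs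
sumMap-∸ g≤f []       = refl
sumMap-∸ g≤f (x ∷ xs) = trans (cong (_ +_) (sumMap-∸ g≤f xs))
  (∸-+-interchange (g≤f x) (sumMap-mono g≤f xs))

sumMap-vanishing : ∀ {xs} → (∀ x → x ∈ xs → f x ≡ 0) → sumMap f xs ≡ 0
sumMap-vanishing {xs = []}     _      = refl
sumMap-vanishing {xs = x ∷ xs} vanish = cong₂ _+_ (vanish x (here refl)) (sumMap-vanishing (λ y → vanish y ∘ there))

∈⇒≤sumMap : ∀ (f : X → ℕ) {x xs} → x ∈ xs → f x ≤ sumMap f xs
∈⇒≤sumMap f {xs = y ∷ ys} (here refl) = m≤m+n (f y) _
∈⇒≤sumMap f {xs = y ∷ ys} (there x∈) = ≤-trans (∈⇒≤sumMap f x∈) (m≤n+m _ (f y))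

sumMap≢0⇒nonzero : ∀ (f : X → ℕ) xs → sumMap f xs ≢ 0 → ∃ λ x → f x ≢ 0
sumMap≢0⇒nonzero f []       ne = ⊥-elim (ne refl)
sumMap≢0⇒nonzero f (x ∷ xs) ne with f x ≟ 0
... | no fx≢0 = x , fx≢0
... | yes fx≡0 = sumMap≢0⇒nonzero f xs (λ e → ne (cong₂ _+_ fx≡0 e))

∈⇒↭∷ : ∀ {x : X} {ys} → x ∈ ys → ∃ λ ys′ → ys ↭ x ∷ ys′
∈⇒↭∷ x∈ys with as , bs , refl ← ∈-∃++ x∈ys = as ++ bs , shift _ as bs

Unique-resp-↭ : ∀ {xs ys : List X} → xs ↭ ys → Unique xs → Unique ys
Unique-resp-↭ {X = X} p = PermutationSetoid.Unique-resp-↭ (setoid X) (↭⇒↭ₛ p)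

-- Membership in a list over a type without decidable equality is decidable
-- only under ¬¬, which suffices because the goal is an equation on ℕ.
sumMap-≡ : ∀ (f : X → ℕ) {xs ys} → Unique xs → Unique ys →
           (∀ z → z ∉ xs → z ∈ ys → f z ≡ 0) → (∀ z → z ∈ xs → z ∉ ys → f z ≡ 0) →
           sumMap f xs ≡ sumMap f ys
sumMap-≡ f {[]} _ _ outˡ _ = sym (sumMap-vanishing (λ z → outˡ z λ ()))
sumMap-≡ f {x ∷ xs} {ys} uxxs@(_ ∷ uxs) uys outˡ outʳ =
  decidable-stable (_ ≟ _) λ neq → ¬¬-excluded-middle {A = x ∈ ys} λ where
    (yes x∈ys) → neq (shared x∈ys)
    (no x∉ys)  → neq (trans (cong (_+ sumMap f xs) (outʳ x (here refl) x∉ys)) (rest x∉ys))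
  where
  x∉xs : x ∉ xs
  x∉xs = Unique[x∷xs]⇒x∉xs uxxs

  shared : x ∈ ys → sumMap f (x ∷ xs) ≡ sumMap f ys
  shared x∈ys with ys′ , ys↭ ← ∈⇒↭∷ x∈ys =
    trans (cong (f x +_) (sumMap-≡ f uxs (drop-cons (Unique-resp-↭ ys↭ uys)) outˡ′ outʳ′))
          (sym (sumMap-↭ f ys↭))
    where
    drop-cons : Unique (x ∷ ys′) → Unique ys′
    drop-cons (_ ∷ u) = u
    x∉ys′ : x ∉ ys′
    x∉ys′ = Unique[x∷xs]⇒x∉xs (Unique-resp-↭ ys↭ uys)
    outˡ′ : ∀ z → z ∉ xs → z ∈ ys′ → f z ≡ 0
    outˡ′ z z∉xs z∈ys′ = outˡ z (λ where (here refl) → x∉ys′ z∈ys′ ; (there z∈xs) → z∉xs z∈xs)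
                                (∈-resp-↭ (↭-sym ys↭) (there z∈ys′))
    outʳ′ : ∀ z → z ∈ xs → z ∉ ys′ → f z ≡ 0
    outʳ′ z z∈xs z∉ys′ = outʳ z (there z∈xs) λ z∈ys → case (∈-resp-↭ ys↭ z∈ys)
      where
      case : z ∈ x ∷ ys′ → _
      case (here refl) = x∉xs z∈xs
      case (there z∈ys′) = z∉ys′ z∈ys′

  rest : x ∉ ys → sumMap f xs ≡ sumMap f ys
  rest x∉ys = sumMap-≡ f uxs uys
    (λ z z∉xs z∈ys → outˡ z (λ where (here refl) → x∉ys z∈ys ; (there z∈xs) → z∉xs z∈xs) z∈ys)
    (λ z z∈xs → outʳ z (there z∈xs))

HasSum⇒sumMap : HasSum f n → ∀ {zs} → Unique zs → VanishesOutside f zs → sumMap f zs ≡ n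
HasSum⇒sumMap {f = f} (xs , uxs , out , eq) uzs outᶻ =
  trans (sumMap-≡ f uzs uxs (λ z z∉ _ → outᶻ z z∉) (λ z _ z∉ → out z z∉)) eq

hasSum-unique : HasSum f m → HasSum f n → m ≡ n
hasSum-unique h (xs , uxs , out , eq) = trans (sym (HasSum⇒sumMap h uxs out)) eq

hasSum-cong : (∀ x → f x ≡ g x) → HasSum f n → HasSum g n
hasSum-cong {f = f} {g} f≡g (xs , uxs , out , eq) =
  xs , uxs , (λ x x∉ → trans (sym (f≡g x)) (out x x∉)) , trans (sym (cong sum (map-cong f≡g xs))) eq

hasSum-0 : (∀ x → f x ≡ 0) → HasSum f 0
hasSum-0 f≡0 = [] , [] , (λ x _ → f≡0 x) , refl

hasSum⇒≤ : HasSum f n → ∀ x → f x ≤ n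
hasSum⇒≤ {f = f} (xs , _ , out , refl) x =
  decidable-stable (f x ≤? sumMap f xs) λ f≰ → ¬¬-excluded-middle {A = x ∈ xs} λ where
  (yes x∈) → f≰ (∈⇒≤sumMap f x∈)
  (no x∉)  → f≰ (subst (_≤ sumMap f xs) (sym (out x x∉)) z≤n)

hasSum-0⇒≡0 : HasSum f 0 → ∀ x → f x ≡ 0
hasSum-0⇒≡0 h x = n≤0⇒n≡0 (hasSum⇒≤ h x)

hasSum⇒nonzero : HasSum f n → n ≢ 0 → ∃ λ x → f x ≢ 0
hasSum⇒nonzero {f = f} (xs , _ , _ , refl) = sumMap≢0⇒nonzero f xs

commonCover : HasSum f m → HasSum g n → Σ (List X) λ zs → Unique zs × VanishesOutside f zs × VanishesOutside g zs
commonCover {f = f} {g = g} (xs , uxs , outᶠ , _) (ys , uys , outᵍ , _) =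
  zs , Unique.++⁺ (Unique.filter⁺ nonzero? uxs) (Unique.filter⁺ zero? uys) disjoint , outᶠ′ , outᵍ′
  where
  nonzero? : ∀ x → Dec (f x ≢ 0)
  nonzero? x = ¬? (f x ≟ 0)
  zero? : ∀ x → Dec (f x ≡ 0)
  zero? x = f x ≟ 0
  zs = filter nonzero? xs ++ filter zero? ys
  disjoint : ∀ {z} → z ∈ filter nonzero? xs × z ∈ filter zero? ys → ⊥
  disjoint (p , q) = proj₂ (∈-filter⁻ nonzero? {xs = xs} p) (proj₂ (∈-filter⁻ zero? {xs = ys} q))
  outᶠ′ : VanishesOutside f zs
  outᶠ′ x x∉ with f x ≟ 0
  ... | yes fx≡0 = fx≡0
  ... | no fx≢0  = outᶠ x (λ x∈ → x∉ (∈-++⁺ˡ (∈-filter⁺ nonzero? x∈ fx≢0)))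
  outᵍ′ : VanishesOutside g zs
  outᵍ′ x x∉ with f x ≟ 0
  ... | yes fx≡0 = outᵍ x (λ x∈ → x∉ (∈-++⁺ʳ _ (∈-filter⁺ zero? x∈ fx≡0)))
  ... | no fx≢0  = ⊥-elim (fx≢0 (outᶠ x (λ x∈ → x∉ (∈-++⁺ˡ (∈-filter⁺ nonzero? x∈ fx≢0)))))

hasSum-+ : HasSum f m → HasSum g n → HasSum (λ x → f x + g x) (m + n)
hasSum-+ {f = f} {g = g} hf hg with zs , uzs , outᶠ , outᵍ ← commonCover hf hg =
  zs , uzs , (λ x x∉ → cong₂ _+_ (outᶠ x x∉) (outᵍ x x∉)) ,
  trans (sumMap-+ f g zs) (cong₂ _+_ (HasSum⇒sumMap hf uzs outᶠ) (HasSum⇒sumMap hg uzs outᵍ))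

hasSum-mono : (∀ x → f x ≤ g x) → HasSum f m → HasSum g n → m ≤ n
hasSum-mono f≤g hf hg with zs , uzs , outᶠ , outᵍ ← commonCover hf hg =
  subst₂ _≤_ (HasSum⇒sumMap hf uzs outᶠ) (HasSum⇒sumMap hg uzs outᵍ) (sumMap-mono f≤g zs)

hasSum-∸ : (∀ x → g x ≤ f x) → HasSum f m → HasSum g n → HasSum (λ x → f x ∸ g x) (m ∸ n)
hasSum-∸ {g = g} {f = f} g≤f (xs , uxs , out , refl) hg =
  xs , uxs , (λ x x∉ → trans (cong (_∸ g x) (out x x∉)) (0∸n≡0 (g x))) ,
  trans (sumMap-∸ g≤f xs) (cong (_ ∸_) (HasSum⇒sumMap hg uxs outᵍ))
  where
  outᵍ : VanishesOutside g xs
  outᵍ x x∉ = n≤0⇒n≡0 (subst (g x ≤_) (out x x∉) (g≤f x))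

hasSum-≤⇒≡ : (∀ x → f x ≤ g x) → HasSum f n → HasSum g n → ∀ x → f x ≡ g x
hasSum-≤⇒≡ {f = f} {g = g} {n = n} f≤g hf hg x =
  ≤-antisym (f≤g x) (m∸n≡0⇒m≤n (hasSum-0⇒≡0 (subst (HasSum _) (n∸n≡0 n) (hasSum-∸ f≤g hg hf)) x))

hasSum-*ˡ : ∀ k → HasSum f n → HasSum (λ x → k * f x) (k * n)
hasSum-*ˡ {f = f} k (xs , uxs , out , eq) =
  xs , uxs , (λ x x∉ → trans (cong (k *_) (out x x∉)) (*-zeroʳ k)) , trans (sumMap-*ˡ k f xs) (cong (k *_) eq)

record DecEmbedding (Y X : Set) : Set where
  field
    embed      : Y → X
    injective  : ∀ {y y′} → embed y ≡ embed y′ → y ≡ y′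
    preimage?  : ∀ x → Dec (Σ Y λ y → embed y ≡ x)

  OffImage : X → Set
  OffImage x = ∀ y → embed y ≢ x

  pullback : List X → List Y
  pullback []       = []
  pullback (x ∷ xs) with preimage? x
  ... | yes (y , _) = y ∷ pullback xs
  ... | no _        = pullback xs

  ∈-pullback⁻ : ∀ {y} xs → y ∈ pullback xs → embed y ∈ xs
  ∈-pullback⁻ (x ∷ xs) y∈ with preimage? x | y∈
  ... | yes (_ , refl) | here refl = here refl
  ... | yes _          | there y∈′ = there (∈-pullback⁻ xs y∈′)
  ... | no _           | y∈′       = there (∈-pullback⁻ xs y∈′)

  ∈-pullback⁺ : ∀ {y} xs → embed y ∈ xs → y ∈ pullback xs
  ∈-pullback⁺ (x ∷ xs) y∈ with preimage? x | y∈
  ... | yes (_ , refl) | here eq   = here (injective eq)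
  ... | yes _          | there y∈′ = there (∈-pullback⁺ xs y∈′)
  ... | no ¬pre        | here refl = ⊥-elim (¬pre (_ , refl))
  ... | no _           | there y∈′ = ∈-pullback⁺ xs y∈′

  pullback-unique : ∀ {xs} → Unique xs → Unique (pullback xs)
  pullback-unique {[]}     []            = []
  pullback-unique {x ∷ xs} (x∉ ∷ uxs) with preimage? x
  ... | yes (y , refl) = All.tabulate (λ {y′} y′∈ y≡y′ → All.lookup x∉ (∈-pullback⁻ xs y′∈) (cong embed y≡y′))
                         ∷ pullback-unique uxs
  ... | no _           = pullback-unique uxs

  sumMap-pullback : ∀ {f : X → ℕ} → (∀ x → OffImage x → f x ≡ 0) → ∀ xs →
                    sumMap (f ∘ embed) (pullback xs) ≡ sumMap f xs
  sumMap-pullback         off []       = refl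
  sumMap-pullback {f = f} off (x ∷ xs) with preimage? x
  ... | yes (_ , refl) = cong (f x +_) (sumMap-pullback off xs)
  ... | no ¬pre        = cong₂ _+_ (sym (off x λ y eq → ¬pre (y , eq))) (sumMap-pullback off xs)

  hasSum-pullback : ∀ {f : X → ℕ} → (∀ x → OffImage x → f x ≡ 0) → HasSum f n → HasSum (f ∘ embed) n
  hasSum-pullback off (xs , uxs , out , eq) =
    pullback xs , pullback-unique uxs , (λ y y∉ → out (embed y) (y∉ ∘ ∈-pullback⁺ xs)) ,
    trans (sumMap-pullback off xs) eq

  hasSum-pushforward : ∀ {f : X → ℕ} → (∀ x → OffImage x → f x ≡ 0) → HasSum (f ∘ embed) n → HasSum f n
  hasSum-pushforward {f = f} off (ys , uys , out , eq) =
    map embed ys , Unique.map⁺ injective uys , out′ , trans (cong sum (sym (map-∘ ys))) eq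
    where
    out′ : VanishesOutside f (map embed ys)
    out′ x x∉ with preimage? x
    ... | yes (y , refl) = out y (x∉ ∘ ∈-map⁺ embed)
    ... | no ¬pre        = off x λ y eq → ¬pre (y , eq)

inj₁-embedding : DecEmbedding X (X ⊎ Y)
inj₁-embedding = record
  { embed = inj₁ ; injective = λ { refl → refl }
  ; preimage? = λ { (inj₁ x) → yes (x , refl) ; (inj₂ _) → no λ () } }

inj₂-embedding : DecEmbedding Y (X ⊎ Y)
inj₂-embedding = record
  { embed = inj₂ ; injective = λ { refl → refl }
  ; preimage? = λ { (inj₁ _) → no (λ ()) ; (inj₂ y) → yes (y , refl) } }

module _ {f : X ⊎ Y → ℕ} where

  hasSum-inj₁ : HasSum (f ∘ inj₁) n → (∀ y → f (inj₂ y) ≡ 0) → HasSum f n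
  hasSum-inj₁ h f₂≡0 = DecEmbedding.hasSum-pushforward inj₁-embedding
    (λ { (inj₁ x) off → ⊥-elim (off x refl) ; (inj₂ y) _ → f₂≡0 y }) h

  hasSum-inj₂ : (∀ x → f (inj₁ x) ≡ 0) → HasSum (f ∘ inj₂) n → HasSum f n
  hasSum-inj₂ f₁≡0 = DecEmbedding.hasSum-pushforward inj₂-embedding
    (λ { (inj₁ x) _ → f₁≡0 x ; (inj₂ y) off → ⊥-elim (off y refl) })

  hasSum-inj₁⁻ : HasSum f n → (∀ y → f (inj₂ y) ≡ 0) → HasSum (f ∘ inj₁) n
  hasSum-inj₁⁻ h f₂≡0 = DecEmbedding.hasSum-pullback inj₁-embedding
    (λ { (inj₁ x) off → ⊥-elim (off x refl) ; (inj₂ y) _ → f₂≡0 y }) h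

  hasSum-inj₂⁻ : HasSum f n → (∀ x → f (inj₁ x) ≡ 0) → HasSum (f ∘ inj₂) n
  hasSum-inj₂⁻ h f₁≡0 = DecEmbedding.hasSum-pullback inj₂-embedding
    (λ { (inj₁ x) _ → f₁≡0 x ; (inj₂ y) off → ⊥-elim (off y refl) }) h

subtype-embedding : {X : Set} {P : X → Set} → (∀ x → Dec (P x)) → (∀ {x} (p q : P x) → p ≡ q) → DecEmbedding (Σ X P) X
subtype-embedding {X} {P} P? irrelevant = record
  { embed = proj₁ ; injective = injective ; preimage? = preimage? }
  where
  injective : ∀ {u v : Σ X P} → proj₁ u ≡ proj₁ v → u ≡ v
  injective {x , p} {_ , q} refl = cong (x ,_) (irrelevant p q)
  preimage? : ∀ x → Dec (Σ (Σ X P) λ u → proj₁ u ≡ x)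
  preimage? x with P? x
  ... | yes p = yes ((x , p) , refl)
  ... | no ¬p = no λ { ((_ , p) , refl) → ¬p p }

hasSum-⊤ : ∀ {f : ⊤ → ℕ} → HasSum f n → f tt ≡ n
hasSum-⊤ h = hasSum-unique (tt ∷ [] , All.[] ∷ [] , (λ { tt tt∉ → ⊥-elim (tt∉ (here refl)) }) , +-identityʳ _) h

hasSum-tt : ∀ {f : ⊤ → ℕ} → HasSum f (f tt)
hasSum-tt = tt ∷ [] , All.[] ∷ [] , (λ { tt tt∉ → ⊥-elim (tt∉ (here refl)) }) , +-identityʳ _

sumMap-cartesianProduct : ∀ (f : X → ℕ) (g : Y → ℕ) xs ys →
  sumMap (λ p → f (proj₁ p) * g (proj₂ p)) (cartesianProduct xs ys) ≡ sumMap f xs * sumMap g ys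
sumMap-cartesianProduct f g []       ys = refl
sumMap-cartesianProduct f g (x ∷ xs) ys = begin
  sumMap h (map (x ,_) ys ++ cartesianProduct xs ys)
    ≡⟨ sumMap-++ h (map (x ,_) ys) _ ⟩
  sumMap h (map (x ,_) ys) + sumMap h (cartesianProduct xs ys)
    ≡⟨ cong₂ _+_ (trans (cong sum (sym (map-∘ ys))) (sumMap-*ˡ (f x) g ys)) (sumMap-cartesianProduct f g xs ys) ⟩
  f x * sumMap g ys + sumMap f xs * sumMap g ys
    ≡⟨ *-distribʳ-+ (sumMap g ys) (f x) _ ⟨
  sumMap f (x ∷ xs) * sumMap g ys ∎
  where
  open ≡-Reasoning
  h = λ p → f (proj₁ p) * g (proj₂ p)

-- Off the cartesian product one factor vanishes; which one is again decided under ¬¬.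
hasSum-× : ∀ {f : X → ℕ} {g : Y → ℕ} → HasSum f m → HasSum g n →
           HasSum (λ p → f (proj₁ p) * g (proj₂ p)) (m * n)
hasSum-× {f = f} {g} (xs , uxs , outᶠ , refl) (ys , uys , outᵍ , refl) =
  cartesianProduct xs ys , Unique.cartesianProduct⁺ uxs uys , out , sumMap-cartesianProduct f g xs ys
  where
  out : VanishesOutside (λ p → f (proj₁ p) * g (proj₂ p)) (cartesianProduct xs ys)
  out (x , y) p∉ = decidable-stable (f x * g y ≟ 0) λ ne →
    ¬¬-excluded-middle {A = x ∈ xs} λ where
      (no x∉) → ne (cong (_* g y) (outᶠ x x∉))
      (yes x∈) → ¬¬-excluded-middle {A = y ∈ ys} λ where
        (no y∉) → ne (trans (cong (f x *_) (outᵍ y y∉)) (*-zeroʳ (f x)))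
        (yes y∈) → p∉ (∈-cartesianProduct⁺ x∈ y∈)

hasSum-≤1-part : ∀ {k} → (∀ x → f x ≤ g x) → HasSum f k → HasSum g n → k ≤ 1 → n ≤ 1 →
                 ∀ x → f x ≡ k * g x
hasSum-≤1-part f≤g hf hg k≤1 n≤1 x with ≤1⇒≡0⊎≡1 k≤1
... | inj₁ refl = hasSum-0⇒≡0 hf x
... | inj₂ refl = trans (hasSum-≤⇒≡ f≤g hf (subst (HasSum _) n≡1 hg) x) (sym (*-identityˡ _))
  where
  n≡1 = ≤-antisym n≤1 (hasSum-mono f≤g hf hg)

0ᴹ : X₁ → X₂ → ℕ
0ᴹ _ _ = 0

_⊕_ : (X₁ → X₂ → ℕ) → (Y₁ → Y₂ → ℕ) → X₁ ⊎ Y₁ → X₂ ⊎ Y₂ → ℕ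
(a ⊕ b) (inj₁ x) (inj₁ y) = a x y
(a ⊕ b) (inj₁ x) (inj₂ y) = 0
(a ⊕ b) (inj₂ x) (inj₁ y) = 0
(a ⊕ b) (inj₂ x) (inj₂ y) = b x y

0ᴹ⊕0ᴹ : ∀ (x : X₁ ⊎ Y₁) (y : X₂ ⊎ Y₂) → (0ᴹ ⊕ 0ᴹ) x y ≡ 0
0ᴹ⊕0ᴹ (inj₁ _) (inj₁ _) = refl
0ᴹ⊕0ᴹ (inj₁ _) (inj₂ _) = refl
0ᴹ⊕0ᴹ (inj₂ _) (inj₁ _) = refl
0ᴹ⊕0ᴹ (inj₂ _) (inj₂ _) = refl

module _ {a : X₁ → X₂ → ℕ} {b : Y₁ → Y₂ → ℕ} {n : ℕ} where

  ⊕-row₁ : ∀ {x} → HasSum (a x) n → HasSum ((a ⊕ b) (inj₁ x)) n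
  ⊕-row₁ h = hasSum-inj₁ h (λ _ → refl)

  ⊕-row₂ : ∀ {x} → HasSum (b x) n → HasSum ((a ⊕ b) (inj₂ x)) n
  ⊕-row₂ h = hasSum-inj₂ (λ _ → refl) h

  ⊕-col₁ : ∀ {y} → HasSum (λ x → a x y) n → HasSum (λ x → (a ⊕ b) x (inj₁ y)) n
  ⊕-col₁ h = hasSum-inj₁ h (λ _ → refl)

  ⊕-col₂ : ∀ {y} → HasSum (λ x → b x y) n → HasSum (λ x → (a ⊕ b) x (inj₂ y)) n
  ⊕-col₂ h = hasSum-inj₂ (λ _ → refl) h

module _ {X Y : Set} where

  _◃_ : (X → ℕ) → (X → Y → ℕ) → X → Y → ℕ
  (m ◃ l) x y = m x * l x y

  _▹_ : (X → Y → ℕ) → (Y → ℕ) → X → Y → ℕ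
  (l ▹ m) x y = m y * l x y

module _ {Act : Set} (N₁ N₂ : PNet Act) where
  private
    module N₁ = PNet N₁
    module N₂ = PNet N₂

  record Response (𝓑 : Linking N₁ N₂ → Set) (l c : Linking N₁ N₂) (t₁ : N₁.T) : Set where
    constructor response
    field
      t₂       : N₂.T
      ℓ≡       : N₂.ℓ t₂ ≡ N₁.ℓ t₁
      π₂c      : π₂≡ N₁ N₂ c (N₂.pre t₂)
      c̄        : Linking N₁ N₂
      π₁c̄      : π₁≡ N₁ N₂ c̄ (N₁.post t₁)
      π₂c̄      : π₂≡ N₁ N₂ c̄ (N₂.post t₂)
      updated∈ : 𝓑 (update N₁ N₂ l c c̄)

  Simulation : (Linking N₁ N₂ → Set) → Set
  Simulation 𝓑 =
    ∀ l c (t₁ : N₁.T) → 𝓑 l → _≤ᴸ_ N₁ N₂ c l → π₁≡ N₁ N₂ c (N₁.pre t₁) → Response 𝓑 l c t₁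

  flipᴸ : Linking N₁ N₂ → Linking N₂ N₁
  flipᴸ l s₂ s₁ = l s₁ s₂

  converse : (Linking N₁ N₂ → Set) → Linking N₂ N₁ → Set
  converse 𝓑 l = 𝓑 λ s₁ s₂ → l s₂ s₁

module _ {Act : Set} {N₁ N₂ : PNet Act} where

  IsSPBisimulation⇒converse-Simulation : ∀ {𝓑} → IsSPBisimulation N₁ N₂ 𝓑 → Simulation N₂ N₁ (converse N₁ N₂ 𝓑)
  IsSPBisimulation⇒converse-Simulation (_ , backward) l c t₂ l∈ c≤l πc
    with t₁ , ℓ≡ , π₁c , c̄ , π₁c̄ , π₂c̄ , l′∈ ←
           backward (flipᴸ N₂ N₁ l) (flipᴸ N₂ N₁ c) t₂ l∈ (λ s₁ s₂ → c≤l s₂ s₁) πc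
    = response t₁ ℓ≡ π₁c (flipᴸ N₁ N₂ c̄) π₂c̄ π₁c̄ l′∈

  IsSPBisimulation⇒Simulation : ∀ {𝓑} → IsSPBisimulation N₁ N₂ 𝓑 → Simulation N₁ N₂ 𝓑
  IsSPBisimulation⇒Simulation (forward , _) l c t₁ l∈ c≤l πc
    with t₂ , ℓ≡ , π₂c , c̄ , π₁c̄ , π₂c̄ , l′∈ ← forward l c t₁ l∈ c≤l πc
    = response t₂ ℓ≡ π₂c c̄ π₁c̄ π₂c̄ l′∈

  Simulations⇒IsSPBisimulation : ∀ {𝓑 𝓒} → Simulation N₁ N₂ 𝓑 → Simulation N₂ N₁ 𝓒 →
    (∀ {l} → 𝓑 l → 𝓒 (flipᴸ N₁ N₂ l)) → (∀ {l} → 𝓒 l → 𝓑 (flipᴸ N₂ N₁ l)) →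
    IsSPBisimulation N₁ N₂ 𝓑
  Simulations⇒IsSPBisimulation forward backward 𝓑⇒𝓒 𝓒⇒𝓑 =
    (λ l c t₁ l∈ c≤l πc → let open Response (forward l c t₁ l∈ c≤l πc)
                          in t₂ , ℓ≡ , π₂c , c̄ , π₁c̄ , π₂c̄ , updated∈) ,
    (λ l c u l∈ c≤l πc →
       let open Response (backward (flipᴸ N₁ N₂ l) (flipᴸ N₁ N₂ c) u (𝓑⇒𝓒 l∈) (λ s₂ s₁ → c≤l s₁ s₂) πc)
       in t₂ , ℓ≡ , π₂c , flipᴸ N₂ N₁ c̄ , π₂c̄ , π₁c̄ , 𝓒⇒𝓑 updated∈)

module _ {Act : Set} (R : Act → Act → Set) where

  relabel-Simulation : ∀ {N₁ N₂ 𝓑} → Simulation N₁ N₂ 𝓑 → Simulation (relabelᴺ R N₁) (relabelᴺ R N₂) 𝓑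
  relabel-Simulation sim l c (t₁ , b , r) l∈ c≤l πc
    with response t₂ ℓ≡ π₂c c̄ π₁c̄ π₂c̄ l′∈ ← sim l c t₁ l∈ c≤l πc
    = response (t₂ , b , subst (λ a → R a b) (sym ℓ≡) r) refl π₂c c̄ π₁c̄ π₂c̄ l′∈

  relabel-↔sp : (N₁ N₂ : PNet Act) → _↔sp_ N₁ N₂ → _↔sp_ (relabelᴺ R N₁) (relabelᴺ R N₂)
  relabel-↔sp N₁ N₂ (A⇔ , 𝓑 , isBisim , l , l∈ , π₁l , π₂l) =
    (λ b → mk⇔ (λ (a , x , r) → a , Equivalence.to (A⇔ a) x , r) (λ (a , x , r) → a , Equivalence.from (A⇔ a) x , r)) ,
    𝓑 ,
    Simulations⇒IsSPBisimulation {N₁ = relabelᴺ R N₁} {N₂ = relabelᴺ R N₂}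
      (relabel-Simulation {N₁} {N₂} (IsSPBisimulation⇒Simulation isBisim))
      (relabel-Simulation {N₂} {N₁} (IsSPBisimulation⇒converse-Simulation {N₁ = N₁} {N₂ = N₂} isBisim))
      (λ l∈ → l∈) (λ l∈ → l∈) ,
    l , l∈ , π₁l , π₂l

module _ {Act : Set} (a : Act) (N₁ N₂ : PNet Act) where
  private
    module N₁ = PNet N₁
    module N₂ = PNet N₂
    P₁ = prefixᴺ a N₁
    P₂ = prefixᴺ a N₂

  innerᴸ : Linking P₁ P₂ → Linking N₁ N₂
  innerᴸ l x y = l (inj₂ x) (inj₂ y)

  -- Each token on the fresh place holds a copy of the initial linking il in reserve,
  -- released when the prefix fires: with k tokens there, l + k · il lies in 𝓑.
  record PrefixLinking (𝓑 : Linking N₁ N₂ → Set) (il : Linking N₁ N₂) (l : Linking P₁ P₂) : Set where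
    constructor prefixLinking
    field
      target  : Linking N₁ N₂
      target∈ : 𝓑 target
      row⋆≡0  : ∀ y → l (inj₁ tt) (inj₂ y) ≡ 0
      col⋆≡0  : ∀ x → l (inj₂ x) (inj₁ tt) ≡ 0
      reserve : ∀ x y → innerᴸ l x y + l (inj₁ tt) (inj₁ tt) * il x y ≡ target x y

  module _ {𝓑 : Linking N₁ N₂ → Set} (sim : Simulation N₁ N₂ 𝓑) {il : Linking N₁ N₂}
           (π₁il : π₁≡ N₁ N₂ il N₁.M₀) (π₂il : π₂≡ N₁ N₂ il N₂.M₀) where

    prefix-Simulation : Simulation P₁ P₂ (PrefixLinking 𝓑 il)
    prefix-Simulation l c (inj₁ tt) (prefixLinking w w∈ off₁ off₂ inner) c≤l πc =
      response (inj₁ tt) refl π₂c (0ᴹ ⊕ il) π₁c̄ π₂c̄ (prefixLinking w w∈ off₁′ off₂′ inner′)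
      where
      c-inner : ∀ x y → c (inj₂ x) y ≡ 0
      c-inner x = hasSum-0⇒≡0 (πc (inj₂ x))
      c⋆₂ : ∀ y → c (inj₁ tt) (inj₂ y) ≡ 0
      c⋆₂ y = ≤-≡0 (c≤l _ _) (off₁ y)
      c⋆⋆ : c (inj₁ tt) (inj₁ tt) ≡ 1
      c⋆⋆ = hasSum-⊤ (hasSum-inj₁⁻ (πc (inj₁ tt)) c⋆₂)
      π₂c : π₂≡ P₁ P₂ c (PNet.pre P₂ (inj₁ tt))
      π₂c (inj₁ tt) = hasSum-inj₁ (subst (HasSum _) c⋆⋆ hasSum-tt) (λ x → c-inner x _)
      π₂c (inj₂ y)  = hasSum-0 λ { (inj₁ tt) → c⋆₂ y ; (inj₂ x) → c-inner x _ }
      π₁c̄ : π₁≡ P₁ P₂ (0ᴹ ⊕ il) (PNet.post P₁ (inj₁ tt))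
      π₁c̄ (inj₁ tt) = ⊕-row₁ (hasSum-0 λ _ → refl)
      π₁c̄ (inj₂ x)  = ⊕-row₂ (π₁il x)
      π₂c̄ : π₂≡ P₁ P₂ (0ᴹ ⊕ il) (PNet.post P₂ (inj₁ tt))
      π₂c̄ (inj₁ tt) = ⊕-col₁ (hasSum-0 λ _ → refl)
      π₂c̄ (inj₂ y)  = ⊕-col₂ (π₂il y)
      off₁′ : ∀ y → l (inj₁ tt) (inj₂ y) ∸ c (inj₁ tt) (inj₂ y) + 0 ≡ 0
      off₁′ y = ∸-+0-≡0 (c _ _) (off₁ y)
      off₂′ : ∀ x → l (inj₂ x) (inj₁ tt) ∸ c (inj₂ x) (inj₁ tt) + 0 ≡ 0
      off₂′ x = ∸-+0-≡0 (c _ _) (off₂ x)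
      inner′ : ∀ x y → l (inj₂ x) (inj₂ y) ∸ c (inj₂ x) (inj₂ y) + il x y
                       + (l (inj₁ tt) (inj₁ tt) ∸ c (inj₁ tt) (inj₁ tt) + 0) * il x y ≡ w x y
      inner′ x y rewrite c-inner x (inj₂ y) | c⋆⋆ =
        trans (release (subst (_≤ _) c⋆⋆ (c≤l (inj₁ tt) (inj₁ tt)))) (inner x y)
        where
        release : ∀ {k} → 1 ≤ k → l (inj₂ x) (inj₂ y) + il x y + (k ∸ 1 + 0) * il x y ≡ l (inj₂ x) (inj₂ y) + k * il x y
        release {suc k} _ rewrite +-identityʳ k = +-assoc (l (inj₂ x) (inj₂ y)) (il x y) (k * il x y)
    prefix-Simulation l c (inj₂ t) (prefixLinking w w∈ off₁ off₂ inner) c≤l πc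
      with response t₂ ℓ≡ π₂c′ c̄ π₁c̄ π₂c̄ w′∈ ←
             sim w (innerᴸ c) t w∈ (λ x y → ≤-trans (c≤l _ _) (subst (_ ≤_) (inner x y) (m≤m+n _ _)))
                 (λ x → hasSum-inj₂⁻ (πc (inj₂ x)) (λ _ → ≤-≡0 (c≤l _ _) (off₂ x))) =
      response (inj₂ t₂) ℓ≡ π₂c (0ᴹ ⊕ c̄)
        (λ { (inj₁ tt) → ⊕-row₁ (hasSum-0 λ _ → refl) ; (inj₂ x) → ⊕-row₂ (π₁c̄ x) })
        (λ { (inj₁ tt) → ⊕-col₁ (hasSum-0 λ _ → refl) ; (inj₂ y) → ⊕-col₂ (π₂c̄ y) })
        (prefixLinking (update N₁ N₂ w (innerᴸ c) c̄) w′∈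
           (λ y → ∸-+0-≡0 (c _ _) (off₁ y)) (λ x → ∸-+0-≡0 (c _ _) (off₂ x)) inner′)
      where
      c⋆ : ∀ y → c (inj₁ tt) y ≡ 0
      c⋆ = hasSum-0⇒≡0 (πc (inj₁ tt))
      π₂c : π₂≡ P₁ P₂ c (PNet.pre P₂ (inj₂ t₂))
      π₂c (inj₁ tt) = hasSum-0 λ { (inj₁ tt) → c⋆ (inj₁ tt) ; (inj₂ x) → ≤-≡0 (c≤l _ _) (off₂ x) }
      π₂c (inj₂ y)  = hasSum-inj₂ (λ _ → c⋆ (inj₂ y)) (π₂c′ y)
      inner′ : ∀ x y → l (inj₂ x) (inj₂ y) ∸ innerᴸ c x y + c̄ x y
                       + (l (inj₁ tt) (inj₁ tt) ∸ c (inj₁ tt) (inj₁ tt) + 0) * il x y ≡ update N₁ N₂ w (innerᴸ c) c̄ x y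
      inner′ x y rewrite c⋆ (inj₁ tt) | +-identityʳ (l (inj₁ tt) (inj₁ tt)) =
        trans (∸-+-+-comm (c̄ x y) _ (c≤l _ _)) (cong (λ z → z ∸ innerᴸ c x y + c̄ x y) (inner x y))

module _ {Act : Set} (a : Act) {N₁ N₂ : PNet Act} where

  PrefixLinking-flip : ∀ {𝓑 il l} → PrefixLinking a N₁ N₂ 𝓑 il l →
    PrefixLinking a N₂ N₁ (converse N₁ N₂ 𝓑) (flipᴸ N₁ N₂ il) (flipᴸ (prefixᴺ a N₁) (prefixᴺ a N₂) l)
  PrefixLinking-flip (prefixLinking w w∈ off₁ off₂ inner) =
    prefixLinking (flipᴸ N₁ N₂ w) w∈ off₂ off₁ λ y x → inner x y

prefix-↔sp : ∀ {Act} (a : Act) (N₁ N₂ : PNet Act) → _↔sp_ N₁ N₂ → _↔sp_ (prefixᴺ a N₁) (prefixᴺ a N₂)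
prefix-↔sp a N₁ N₂ (A⇔ , 𝓑 , isBisim , il , il∈ , π₁il , π₂il) =
  (λ b → mk⇔ (⊎-map (Equivalence.to (A⇔ b)) (λ e → e)) (⊎-map (Equivalence.from (A⇔ b)) (λ e → e))) ,
  PrefixLinking a N₁ N₂ 𝓑 il ,
  Simulations⇒IsSPBisimulation {N₁ = prefixᴺ a N₁} {N₂ = prefixᴺ a N₂}
    (prefix-Simulation a N₁ N₂ (IsSPBisimulation⇒Simulation isBisim) π₁il π₂il)
    (prefix-Simulation a N₂ N₁ (IsSPBisimulation⇒converse-Simulation {N₁ = N₁} {N₂ = N₂} isBisim) π₂il π₁il)
    (PrefixLinking-flip a {N₁} {N₂}) (PrefixLinking-flip a {N₂} {N₁}) ,
  (λ _ _ → 1) ⊕ 0ᴹ , prefixLinking il il∈ (λ _ → refl) (λ _ → refl) (λ x y → *-identityˡ (il x y)) ,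
  (λ { (inj₁ tt) → ⊕-row₁ hasSum-tt ; (inj₂ x) → ⊕-row₂ (hasSum-0 λ _ → refl) }) ,
  (λ { (inj₁ tt) → ⊕-col₁ hasSum-tt ; (inj₂ y) → ⊕-col₂ (hasSum-0 λ _ → refl) })

module _ {Act : Set} (L₁ L₂ R₁ R₂ : PNet Act) where
  private
    module L₁ = PNet L₁
    module L₂ = PNet L₂
    module R₁ = PNet R₁
    module R₂ = PNet R₂
    Q₁ = parᴺ L₁ R₁
    Q₂ = parᴺ L₂ R₂

  record ParLinking (𝓑ˡ : Linking L₁ L₂ → Set) (𝓑ʳ : Linking R₁ R₂ → Set) (l : Linking Q₁ Q₂) : Set where
    constructor parLinking
    field
      left    : Linking L₁ L₂
      right   : Linking R₁ R₂
      left∈   : 𝓑ˡ left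
      right∈  : 𝓑ʳ right
      left≡   : ∀ x y → l (inj₁ x) (inj₁ y) ≡ left x y
      right≡  : ∀ x y → l (inj₂ x) (inj₂ y) ≡ right x y
      off₁₂   : ∀ x y → l (inj₁ x) (inj₂ y) ≡ 0
      off₂₁   : ∀ x y → l (inj₂ x) (inj₁ y) ≡ 0

  module ParStep {𝓑ˡ : Linking L₁ L₂ → Set} {𝓑ʳ : Linking R₁ R₂ → Set} {l c : Linking Q₁ Q₂}
                 (lrel : ParLinking 𝓑ˡ 𝓑ʳ l) (c≤l : _≤ᴸ_ Q₁ Q₂ c l) where
    open ParLinking lrel public

    cˡ : Linking L₁ L₂
    cˡ x y = c (inj₁ x) (inj₁ y)

    cʳ : Linking R₁ R₂
    cʳ x y = c (inj₂ x) (inj₂ y)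

    cˡ≤left : _≤ᴸ_ L₁ L₂ cˡ left
    cˡ≤left x y = subst (_ ≤_) (left≡ x y) (c≤l _ _)

    cʳ≤right : _≤ᴸ_ R₁ R₂ cʳ right
    cʳ≤right x y = subst (_ ≤_) (right≡ x y) (c≤l _ _)

    c₁₂≡0 : ∀ x y → c (inj₁ x) (inj₂ y) ≡ 0
    c₁₂≡0 x y = ≤-≡0 (c≤l _ _) (off₁₂ x y)

    c₂₁≡0 : ∀ x y → c (inj₂ x) (inj₁ y) ≡ 0
    c₂₁≡0 x y = ≤-≡0 (c≤l _ _) (off₂₁ x y)

    rowˡ : ∀ {x n} → HasSum (c (inj₁ x)) n → HasSum (cˡ x) n
    rowˡ {x} h = hasSum-inj₁⁻ h (c₁₂≡0 x)

    rowʳ : ∀ {x n} → HasSum (c (inj₂ x)) n → HasSum (cʳ x) n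
    rowʳ {x} h = hasSum-inj₂⁻ h (c₂₁≡0 x)

    colˡ : ∀ {y n} → HasSum (λ x → cˡ x y) n → HasSum (λ x → c x (inj₁ y)) n
    colˡ {y} h = hasSum-inj₁ h (λ x → c₂₁≡0 x y)

    colʳ : ∀ {y n} → HasSum (λ x → cʳ x y) n → HasSum (λ x → c x (inj₂ y)) n
    colʳ {y} h = hasSum-inj₂ (λ x → c₁₂≡0 x y) h

    ParLinking-update : ∀ {c̄ˡ c̄ʳ left′ right′} → 𝓑ˡ left′ → 𝓑ʳ right′ →
      (∀ x y → l (inj₁ x) (inj₁ y) ∸ cˡ x y + c̄ˡ x y ≡ left′ x y) →
      (∀ x y → l (inj₂ x) (inj₂ y) ∸ cʳ x y + c̄ʳ x y ≡ right′ x y) →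
      ParLinking 𝓑ˡ 𝓑ʳ (update Q₁ Q₂ l c (c̄ˡ ⊕ c̄ʳ))
    ParLinking-update left′∈ right′∈ left′≡ right′≡ =
      parLinking _ _ left′∈ right′∈ left′≡ right′≡
        (λ x y → ∸-+0-≡0 (c _ _) (off₁₂ x y)) (λ x y → ∸-+0-≡0 (c _ _) (off₂₁ x y))

    moved-left : ∀ {c̄} x y → l (inj₁ x) (inj₁ y) ∸ cˡ x y + c̄ x y ≡ update L₁ L₂ left cˡ c̄ x y
    moved-left {c̄} x y = cong (λ z → z ∸ cˡ x y + c̄ x y) (left≡ x y)

    moved-right : ∀ {c̄} x y → l (inj₂ x) (inj₂ y) ∸ cʳ x y + c̄ x y ≡ update R₁ R₂ right cʳ c̄ x y
    moved-right {c̄} x y = cong (λ z → z ∸ cʳ x y + c̄ x y) (right≡ x y)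

    idle-left : (∀ x y → c (inj₁ x) y ≡ 0) → ∀ x y → l (inj₁ x) (inj₁ y) ∸ cˡ x y + 0 ≡ left x y
    idle-left c≡0 x y rewrite c≡0 x (inj₁ y) = trans (+-identityʳ _) (left≡ x y)

    idle-right : (∀ x y → c (inj₂ x) y ≡ 0) → ∀ x y → l (inj₂ x) (inj₂ y) ∸ cʳ x y + 0 ≡ right x y
    idle-right c≡0 x y rewrite c≡0 x (inj₂ y) = trans (+-identityʳ _) (right≡ x y)

  module _ {𝓑ˡ : Linking L₁ L₂ → Set} {𝓑ʳ : Linking R₁ R₂ → Set}
           (simˡ : Simulation L₁ L₂ 𝓑ˡ) (simʳ : Simulation R₁ R₂ 𝓑ʳ)
           (A₂⊆A₁ˡ : ∀ a → L₂.A a → L₁.A a) (A₂⊆A₁ʳ : ∀ a → R₂.A a → R₁.A a) where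

    par-Simulation : Simulation Q₁ Q₂ (ParLinking 𝓑ˡ 𝓑ʳ)
    par-Simulation l c (inj₁ (t , t∉Aʳ)) lrel c≤l πc =
      response (inj₁ (t₂ , λ A → t∉Aʳ (A₂⊆A₁ʳ _ (subst R₂.A ℓ≡ A)))) ℓ≡
        (λ { (inj₁ y) → colˡ (π₂c y) ; (inj₂ y) → colʳ (hasSum-0 λ x → right-idle x (inj₂ y)) })
        (c̄ ⊕ 0ᴹ)
        (λ { (inj₁ x) → ⊕-row₁ (π₁c̄ x) ; (inj₂ x) → ⊕-row₂ (hasSum-0 λ _ → refl) })
        (λ { (inj₁ y) → ⊕-col₁ (π₂c̄ y) ; (inj₂ y) → ⊕-col₂ (hasSum-0 λ _ → refl) })
        (ParLinking-update updated∈ right∈ moved-left (idle-right right-idle))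
      where
      open ParStep lrel c≤l
      right-idle : ∀ x y → c (inj₂ x) y ≡ 0
      right-idle x = hasSum-0⇒≡0 (πc (inj₂ x))
      open Response (simˡ _ _ t left∈ cˡ≤left (λ x → rowˡ (πc (inj₁ x))))
    par-Simulation l c (inj₂ (inj₁ (t , t∉Aˡ))) lrel c≤l πc =
      response (inj₂ (inj₁ (t₂ , λ A → t∉Aˡ (A₂⊆A₁ˡ _ (subst L₂.A ℓ≡ A))))) ℓ≡
        (λ { (inj₁ y) → colˡ (hasSum-0 λ x → left-idle x (inj₁ y)) ; (inj₂ y) → colʳ (π₂c y) })
        (0ᴹ ⊕ c̄)
        (λ { (inj₁ x) → ⊕-row₁ (hasSum-0 λ _ → refl) ; (inj₂ x) → ⊕-row₂ (π₁c̄ x) })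
        (λ { (inj₁ y) → ⊕-col₁ (hasSum-0 λ _ → refl) ; (inj₂ y) → ⊕-col₂ (π₂c̄ y) })
        (ParLinking-update left∈ updated∈ (idle-left left-idle) moved-right)
      where
      open ParStep lrel c≤l
      left-idle : ∀ x y → c (inj₁ x) y ≡ 0
      left-idle x = hasSum-0⇒≡0 (πc (inj₁ x))
      open Response (simʳ _ _ t right∈ cʳ≤right (λ x → rowʳ (πc (inj₂ x))))
    par-Simulation l c (inj₂ (inj₂ ((t , u) , ℓt≡ℓu))) lrel c≤l πc =
      response (inj₂ (inj₂ ((L.t₂ , R.t₂) , trans L.ℓ≡ (trans ℓt≡ℓu (sym R.ℓ≡))))) L.ℓ≡
        (λ { (inj₁ y) → colˡ (L.π₂c y) ; (inj₂ y) → colʳ (R.π₂c y) })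
        (L.c̄ ⊕ R.c̄)
        (λ { (inj₁ x) → ⊕-row₁ (L.π₁c̄ x) ; (inj₂ x) → ⊕-row₂ (R.π₁c̄ x) })
        (λ { (inj₁ y) → ⊕-col₁ (L.π₂c̄ y) ; (inj₂ y) → ⊕-col₂ (R.π₂c̄ y) })
        (ParLinking-update L.updated∈ R.updated∈ moved-left moved-right)
      where
      open ParStep lrel c≤l
      module L = Response (simˡ _ _ t left∈ cˡ≤left (λ x → rowˡ (πc (inj₁ x))))
      module R = Response (simʳ _ _ u right∈ cʳ≤right (λ x → rowʳ (πc (inj₂ x))))

module _ {Act : Set} {L₁ L₂ R₁ R₂ : PNet Act} where

  ParLinking-flip : ∀ {𝓑ˡ 𝓑ʳ l} → ParLinking L₁ L₂ R₁ R₂ 𝓑ˡ 𝓑ʳ l →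
    ParLinking L₂ L₁ R₂ R₁ (converse L₁ L₂ 𝓑ˡ) (converse R₁ R₂ 𝓑ʳ) (flipᴸ (parᴺ L₁ R₁) (parᴺ L₂ R₂) l)
  ParLinking-flip (parLinking left right left∈ right∈ left≡ right≡ off₁₂ off₂₁) =
    parLinking (flipᴸ L₁ L₂ left) (flipᴸ R₁ R₂ right) left∈ right∈
      (λ y x → left≡ x y) (λ y x → right≡ x y) (λ y x → off₂₁ x y) (λ y x → off₁₂ x y)

par-↔sp : ∀ {Act} (L₁ L₂ R₁ R₂ : PNet Act) →
  _↔sp_ L₁ L₂ → _↔sp_ R₁ R₂ → _↔sp_ (parᴺ L₁ R₁) (parᴺ L₂ R₂)
par-↔sp L₁ L₂ R₁ R₂ (A⇔ˡ , 𝓑ˡ , bisimˡ , il , il∈ , π₁il , π₂il)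
                    (A⇔ʳ , 𝓑ʳ , bisimʳ , ir , ir∈ , π₁ir , π₂ir) =
  (λ a → mk⇔ (⊎-map (Equivalence.to (A⇔ˡ a)) (Equivalence.to (A⇔ʳ a)))
             (⊎-map (Equivalence.from (A⇔ˡ a)) (Equivalence.from (A⇔ʳ a)))) ,
  ParLinking L₁ L₂ R₁ R₂ 𝓑ˡ 𝓑ʳ ,
  Simulations⇒IsSPBisimulation {N₁ = parᴺ L₁ R₁} {N₂ = parᴺ L₂ R₂}
    (par-Simulation L₁ L₂ R₁ R₂ (IsSPBisimulation⇒Simulation bisimˡ) (IsSPBisimulation⇒Simulation bisimʳ)
      (λ a → Equivalence.from (A⇔ˡ a)) (λ a → Equivalence.from (A⇔ʳ a)))
    (par-Simulation L₂ L₁ R₂ R₁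
      (IsSPBisimulation⇒converse-Simulation {N₁ = L₁} {N₂ = L₂} bisimˡ)
      (IsSPBisimulation⇒converse-Simulation {N₁ = R₁} {N₂ = R₂} bisimʳ)
      (λ a → Equivalence.to (A⇔ˡ a)) (λ a → Equivalence.to (A⇔ʳ a)))
    (ParLinking-flip {L₁ = L₁} {L₂} {R₁} {R₂}) (ParLinking-flip {L₁ = L₂} {L₁} {R₂} {R₁}) ,
  il ⊕ ir , parLinking il ir il∈ ir∈ (λ _ _ → refl) (λ _ _ → refl) (λ _ _ → refl) (λ _ _ → refl) ,
  (λ { (inj₁ x) → ⊕-row₁ (π₁il x) ; (inj₂ x) → ⊕-row₂ (π₁ir x) }) ,
  (λ { (inj₁ y) → ⊕-col₁ (π₂il y) ; (inj₂ y) → ⊕-col₂ (π₂ir y) })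

module _ {Act : Set} (N₁ N₂ : PNet Act) (il : Linking N₁ N₂) where
  private
    module N₁ = PNet N₁
    module N₂ = PNet N₂

  record Reserved (𝓑 : Linking N₁ N₂ → Set) (m₁ : N₁.S → ℕ) (m₂ : N₂.S → ℕ) (lb : Linking N₁ N₂) : Set where
    constructor reserved
    field
      target   : Linking N₁ N₂
      target∈  : 𝓑 target
      m₁≤1     : ∀ x → m₁ x ≤ 1
      m₂≤1     : ∀ y → m₂ y ≤ 1
      reserve₁ : ∀ x y → lb x y + m₁ x * il x y ≡ target x y
      reserve₂ : ∀ x y → lb x y + m₂ y * il x y ≡ target x y

    consistent : ∀ x y → m₂ y * il x y ≡ m₁ x * il x y
    consistent x y = +-cancelˡ-≡ (lb x y) _ _ (trans (reserve₂ x y) (sym (reserve₁ x y)))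

  Reserved-idle : ∀ {𝓑 m₁ m₂ lb cb} → (∀ x y → cb x y ≡ 0) →
                  Reserved 𝓑 m₁ m₂ lb → Reserved 𝓑 m₁ m₂ (update N₁ N₂ lb cb 0ᴹ)
  Reserved-idle {lb = lb} {cb} cb≡0 (reserved w w∈ m₁≤1 m₂≤1 reserve₁ reserve₂) =
    reserved w w∈ m₁≤1 m₂≤1 (λ x y → trans (cong (_+ _) (unchanged x y)) (reserve₁ x y))
                            (λ x y → trans (cong (_+ _) (unchanged x y)) (reserve₂ x y))
    where
    unchanged : ∀ x y → lb x y ∸ cb x y + 0 ≡ lb x y
    unchanged x y rewrite cb≡0 x y = +-identityʳ (lb x y)

  record Step (𝓑 : Linking N₁ N₂ → Set) (m₁ : N₁.S → ℕ) (m₂ : N₂.S → ℕ) (lb cb : Linking N₁ N₂)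
              (t : N₁.T) (K : N₁.S → ℕ) (K′ : N₂.S → ℕ) : Set where
    constructor mkStep
    field
      t₂   : N₂.T
      ℓ≡   : N₂.ℓ t₂ ≡ N₁.ℓ t
      π₂cb : ∀ y → HasSum (λ x → cb x y) (N₂.pre t₂ y ∸ K′ y)
      c̄    : Linking N₁ N₂
      π₁c̄  : π₁≡ N₁ N₂ c̄ (N₁.post t)
      π₂c̄  : π₂≡ N₁ N₂ c̄ (N₂.post t₂)
      next : Reserved 𝓑 (λ x → m₁ x ∸ K x) (λ y → m₂ y ∸ K′ y) (update N₁ N₂ lb cb c̄)

module _ {Act : Set} {N₁ N₂ : PNet Act} {il : Linking N₁ N₂} where

  Reserved-flip : ∀ {𝓑 m₁ m₂ lb} → Reserved N₁ N₂ il 𝓑 m₁ m₂ lb →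
    Reserved N₂ N₁ (flipᴸ N₁ N₂ il) (converse N₁ N₂ 𝓑) m₂ m₁ (flipᴸ N₁ N₂ lb)
  Reserved-flip (reserved w w∈ m₁≤1 m₂≤1 reserve₁ reserve₂) =
    reserved (flipᴸ N₁ N₂ w) w∈ m₂≤1 m₁≤1 (λ y x → reserve₂ x y) (λ y x → reserve₁ x y)

module InitialLinking {Act : Set} {N₁ N₂ : PNet Act} {il : Linking N₁ N₂}
               (π₁il : π₁≡ N₁ N₂ il (PNet.M₀ N₁)) (π₂il : π₂≡ N₁ N₂ il (PNet.M₀ N₂))
               (plain₁ : ∀ x → PNet.M₀ N₁ x ≤ 1) (plain₂ : ∀ y → PNet.M₀ N₂ y ≤ 1) where
  private
    module N₁ = PNet N₁
    module N₂ = PNet N₂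

  -- The initial places of N₂ linked to K ≤ M₁ by il; t^K is answered by t₂^(push K).
  push : (N₁.S → ℕ) → N₂.S → ℕ
  push K y = sumMap (λ x → K x * il x y) (proj₁ (π₂il y))

  hasSum-push : ∀ K y → HasSum (λ x → K x * il x y) (push K y)
  hasSum-push K y with xs , uxs , out , _ ← π₂il y =
    xs , uxs , (λ x x∉ → trans (cong (K x *_) (out x x∉)) (*-zeroʳ (K x))) , refl

  module _ {K : N₁.S → ℕ} (K≤1 : ∀ x → K x ≤ 1) where

    K*il≤il : ∀ x y → K x * il x y ≤ il x y
    K*il≤il x y = ≤-trans (*-monoˡ-≤ (il x y) (K≤1 x)) (≤-reflexive (*-identityˡ (il x y)))

    push≤M₂ : ∀ y → push K y ≤ N₂.M₀ y
    push≤M₂ y = hasSum-mono (λ x → K*il≤il x y) (hasSum-push K y) (π₂il y)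

    push-*-il : ∀ x y → K x * il x y ≡ push K y * il x y
    push-*-il x y = hasSum-≤1-part (λ x → K*il≤il x y) (hasSum-push K y) (π₂il y)
                      (≤-trans (push≤M₂ y) (plain₂ y)) (plain₂ y) x

  push-nonzero : ∀ {K x} → K x ≢ 0 → K x ≤ N₁.M₀ x → ∃ λ y → push K y ≢ 0
  push-nonzero {K} {x} Kx≢0 Kx≤M
    with y , ilxy≢0 ← hasSum⇒nonzero (π₁il x) (λ M≡0 → Kx≢0 (n≤0⇒n≡0 (subst (K x ≤_) M≡0 Kx≤M))) =
    y , λ push≡0 → ilxy≢0 (n≤0⇒n≡0 (subst (il x y ≤_) push≡0
          (≤-trans (m≤n*m (il x y) (K x) {{≢-nonZero Kx≢0}}) (hasSum⇒≤ (hasSum-push K y) x))))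

  consistent-∸ : ∀ {𝓑 m₁ m₂ lb K} → Reserved N₁ N₂ il 𝓑 m₁ m₂ lb → (∀ x → K x ≤ 1) →
                 ∀ x y → (m₂ y ∸ push K y) * il x y ≡ (m₁ x ∸ K x) * il x y
  consistent-∸ {m₁ = m₁} {m₂} {K = K} r K≤1 x y = begin
    (m₂ y ∸ push K y) * il x y          ≡⟨ *-distribʳ-∸ (il x y) (m₂ y) (push K y) ⟩
    m₂ y * il x y ∸ push K y * il x y   ≡⟨ cong₂ _∸_ (Reserved.consistent r x y) (sym (push-*-il K≤1 x y)) ⟩
    m₁ x * il x y ∸ K x * il x y        ≡⟨ *-distribʳ-∸ (il x y) (m₁ x) (K x) ⟨
    (m₁ x ∸ K x) * il x y               ∎
    where open ≡-Reasoning

  module _ {𝓑 : Linking N₁ N₂ → Set} (sim : Simulation N₁ N₂ 𝓑)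
           {m₁ m₂ lb cb} (r : Reserved N₁ N₂ il 𝓑 m₁ m₂ lb) (cb≤lb : _≤ᴸ_ N₁ N₂ cb lb) where
    open Reserved r

    plain-step : ∀ {t} → π₁≡ N₁ N₂ cb (N₁.pre t) → Step N₁ N₂ il 𝓑 m₁ m₂ lb cb t (λ _ → 0) (λ _ → 0)
    plain-step {t} π₁cb = mkStep t₂ ℓ≡ π₂c c̄ π₁c̄ π₂c̄
      (reserved _ updated∈ m₁≤1 m₂≤1 (moved (λ x _ → m₁ x) reserve₁) (moved (λ _ y → m₂ y) reserve₂))
      where
      open Response (sim target cb t target∈
                      (λ x y → ≤-trans (cb≤lb x y) (subst (lb x y ≤_) (reserve₁ x y) (m≤m+n _ _))) π₁cb)
      moved : ∀ (m : N₁.S → N₂.S → ℕ) → (∀ x y → lb x y + m x y * il x y ≡ target x y) →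
              ∀ x y → lb x y ∸ cb x y + c̄ x y + m x y * il x y ≡ target x y ∸ cb x y + c̄ x y
      moved _ reserve x y = trans (∸-+-+-comm (c̄ x y) _ (cb≤lb x y)) (cong (λ z → z ∸ cb x y + c̄ x y) (reserve x y))

    -- The reserved copy K · il of the linking is consumed together with cb.
    K-step : ∀ {t K} → (∀ x → K x ≤ N₁.pre t x ⊓ N₁.M₀ x) → (∀ x → K x ≤ m₁ x) →
             (∀ x → HasSum (cb x) (N₁.pre t x ∸ K x)) →
             Σ (Step N₁ N₂ il 𝓑 m₁ m₂ lb cb t K (push K)) λ s →
               ∀ y → push K y ≤ N₂.pre (Step.t₂ s) y ⊓ N₂.M₀ y
    K-step {t} {K} K≤pre⊓M K≤m₁ π₁cb =
      mkStep t₂ ℓ≡ π₂cb c̄ π₁c̄ π₂c̄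
        (reserved _ updated∈ (λ x → ≤-trans (m∸n≤m (m₁ x) (K x)) (m₁≤1 x))
                  (λ y → ≤-trans (m∸n≤m (m₂ y) (push K y)) (m₂≤1 y)) consumed₁ consumed₂) ,
      λ y → ⊓-glb (hasSum-mono (λ x → m≤n+m _ (cb x y)) (hasSum-push K y) (π₂c y)) (push≤M₂ K≤1 y)
      where
      K≤M₁ : ∀ x → K x ≤ N₁.M₀ x
      K≤M₁ x = ≤-trans (K≤pre⊓M x) (m⊓n≤n _ _)
      K≤1 : ∀ x → K x ≤ 1
      K≤1 x = ≤-trans (K≤M₁ x) (plain₁ x)
      d : Linking N₁ N₂
      d x y = cb x y + K x * il x y
      K*M₁≡K : ∀ x → K x * N₁.M₀ x ≡ K x
      K*M₁≡K x with ≤1⇒≡0⊎≡1 (plain₁ x)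
      ... | inj₁ M≡0 = trans (cong (K x *_) M≡0) (trans (*-zeroʳ (K x)) (sym (n≤0⇒n≡0 (subst (K x ≤_) M≡0 (K≤M₁ x)))))
      ... | inj₂ M≡1 = trans (cong (K x *_) M≡1) (*-identityʳ (K x))
      π₁d : π₁≡ N₁ N₂ d (N₁.pre t)
      π₁d x = subst (HasSum (d x))
                (trans (cong (N₁.pre t x ∸ K x +_) (K*M₁≡K x)) (m∸n+n≡m (≤-trans (K≤pre⊓M x) (m⊓n≤m _ _))))
                (hasSum-+ (π₁cb x) (hasSum-*ˡ (K x) (π₁il x)))
      d≤target : _≤ᴸ_ N₁ N₂ d target
      d≤target x y = subst (_ ≤_) (reserve₁ x y) (+-mono-≤ (cb≤lb x y) (*-monoˡ-≤ (il x y) (K≤m₁ x)))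
      open Response (sim target d t target∈ d≤target π₁d)
      π₂cb : ∀ y → HasSum (λ x → cb x y) (N₂.pre t₂ y ∸ push K y)
      π₂cb y = hasSum-cong (λ x → m+n∸n≡m (cb x y) (K x * il x y))
                 (hasSum-∸ (λ x → m≤n+m _ (cb x y)) (π₂c y) (hasSum-push K y))
      consumed₁ : ∀ x y → lb x y ∸ cb x y + c̄ x y + (m₁ x ∸ K x) * il x y ≡ target x y ∸ d x y + c̄ x y
      consumed₁ x y = begin
        lb x y ∸ cb x y + c̄ x y + (m₁ x ∸ K x) * il x y
          ≡⟨ cong (lb x y ∸ cb x y + c̄ x y +_) (*-distribʳ-∸ (il x y) (m₁ x) (K x)) ⟩
        lb x y ∸ cb x y + c̄ x y + (m₁ x * il x y ∸ K x * il x y)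
          ≡⟨ xy∙z≈xz∙y (lb x y ∸ cb x y) (c̄ x y) _ ⟩
        lb x y ∸ cb x y + (m₁ x * il x y ∸ K x * il x y) + c̄ x y
          ≡⟨ cong (_+ c̄ x y) (∸-+-interchange (cb≤lb x y) (*-monoˡ-≤ (il x y) (K≤m₁ x))) ⟩
        lb x y + m₁ x * il x y ∸ d x y + c̄ x y
          ≡⟨ cong (λ z → z ∸ d x y + c̄ x y) (reserve₁ x y) ⟩
        target x y ∸ d x y + c̄ x y ∎
        where open ≡-Reasoning
      consumed₂ : ∀ x y → lb x y ∸ cb x y + c̄ x y + (m₂ y ∸ push K y) * il x y ≡ target x y ∸ d x y + c̄ x y
      consumed₂ x y = trans (cong (lb x y ∸ cb x y + c̄ x y +_) (consistent-∸ r K≤1 x y)) (consumed₁ x y)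

module _ {Act : Set} {X Y : PNet Act} where
  private
    module X = PNet X
    module Y = PNet Y

  placeˡ : ChoicePlace X Y → X.S
  placeˡ p = proj₁ (proj₁ p)

  placeʳ : ChoicePlace X Y → Y.S
  placeʳ p = proj₂ (proj₁ p)

  placeˡ-marked : (∀ x → X.M₀ x ≤ 1) → ∀ p → X.M₀ (placeˡ p) ≡ 1
  placeˡ-marked plain ((x , _) , 1≤M , _) = ≤-antisym (plain x) 1≤M

  placeʳ-marked : (∀ y → Y.M₀ y ≤ 1) → ∀ p → Y.M₀ (placeʳ p) ≡ 1
  placeʳ-marked plain ((_ , y) , _ , 1≤M) = ≤-antisym (plain y) 1≤M

  hasSum-ChoicePlace : ∀ {f : X.S → ℕ} {g : Y.S → ℕ} {m n} → HasSum f m → HasSum g n →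
    (∀ x → f x ≢ 0 → 1 ≤ X.M₀ x) → (∀ y → g y ≢ 0 → 1 ≤ Y.M₀ y) →
    HasSum (λ p → f (placeˡ p) * g (placeʳ p)) (m * n)
  hasSum-ChoicePlace {f} {g} hf hg suppᶠ suppᵍ =
    DecEmbedding.hasSum-pullback (subtype-embedding marked? irrelevant) off (hasSum-× hf hg)
    where
    marked? : ∀ p → Dec ((1 ≤ X.M₀ (proj₁ p)) × (1 ≤ Y.M₀ (proj₂ p)))
    marked? (x , y) = (1 ≤? X.M₀ x) ×-dec (1 ≤? Y.M₀ y)
    irrelevant : ∀ {p} (u v : (1 ≤ X.M₀ (proj₁ p)) × (1 ≤ Y.M₀ (proj₂ p))) → u ≡ v
    irrelevant (u₁ , u₂) (v₁ , v₂) = cong₂ _,_ (≤-irrelevant u₁ v₁) (≤-irrelevant u₂ v₂)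
    off : ∀ p → (∀ q → proj₁ q ≢ p) → f (proj₁ p) * g (proj₂ p) ≡ 0
    off (x , y) unmarked with f x ≟ 0 | g y ≟ 0
    ... | yes fx≡0 | _         = cong (_* g y) fx≡0
    ... | no _     | yes gy≡0  = trans (cong (f x *_) gy≡0) (*-zeroʳ (f x))
    ... | no fx≢0  | no gy≢0   = ⊥-elim (unmarked ((x , y) , suppᶠ x fx≢0 , suppᵍ y gy≢0) refl)

module _ {Act : Set} (L₁ L₂ R₁ R₂ : PNet Act) where
  private
    module L₁ = PNet L₁
    module L₂ = PNet L₂
    module R₁ = PNet R₁
    module R₂ = PNet R₂
    C₁ = choiceᴺ L₁ R₁
    C₂ = choiceᴺ L₂ R₂
    P₁ = ChoicePlace L₁ R₁
    P₂ = ChoicePlace L₂ R₂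
    placeˡ₁ = placeˡ {X = L₁} {R₁}
    placeʳ₁ = placeʳ {X = L₁} {R₁}
    placeˡ₂ = placeˡ {X = L₂} {R₂}
    placeʳ₂ = placeʳ {X = L₂} {R₂}

  _⊗_ : Linking L₁ L₂ → Linking R₁ R₂ → P₁ → P₂ → ℕ
  (f ⊗ g) p q = f (placeˡ₁ p) (placeˡ₂ q) * g (placeʳ₁ p) (placeʳ₂ q)

  -- The choice places carry the product of both initial linkings, restricted by
  -- flags to the initially marked places not consumed yet; the same flags say
  -- which part of each component linking is still held in reserve there.
  record ChoiceLinking (𝓑ˡ : Linking L₁ L₂ → Set) (𝓑ʳ : Linking R₁ R₂ → Set)
                       (il : Linking L₁ L₂) (ir : Linking R₁ R₂) (l : Linking C₁ C₂) : Set where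
    constructor choiceLinking
    field
      mˡ₁      : L₁.S → ℕ
      mˡ₂      : L₂.S → ℕ
      mʳ₁      : R₁.S → ℕ
      mʳ₂      : R₂.S → ℕ
      left     : Reserved L₁ L₂ il 𝓑ˡ mˡ₁ mˡ₂ (λ x y → l (inj₁ x) (inj₁ y))
      right    : Reserved R₁ R₂ ir 𝓑ʳ mʳ₁ mʳ₂ (λ x y → l (inj₂ (inj₁ x)) (inj₂ (inj₁ y)))
      product₁ : ∀ p q → l (inj₂ (inj₂ p)) (inj₂ (inj₂ q)) ≡ ((mˡ₁ ◃ il) ⊗ (mʳ₁ ◃ ir)) p q
      product₂ : ∀ p q → l (inj₂ (inj₂ p)) (inj₂ (inj₂ q)) ≡ ((il ▹ mˡ₂) ⊗ (ir ▹ mʳ₂)) p q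
      offˡ₁    : ∀ x y → l (inj₁ x) (inj₂ y) ≡ 0
      offˡ₂    : ∀ x y → l (inj₂ x) (inj₁ y) ≡ 0
      offʳ₁    : ∀ x q → l (inj₂ (inj₁ x)) (inj₂ (inj₂ q)) ≡ 0
      offʳ₂    : ∀ p y → l (inj₂ (inj₂ p)) (inj₂ (inj₁ y)) ≡ 0

  module _ {𝓑ˡ : Linking L₁ L₂ → Set} {𝓑ʳ : Linking R₁ R₂ → Set} {il : Linking L₁ L₂} {ir : Linking R₁ R₂}
           (π₁il : π₁≡ L₁ L₂ il L₁.M₀) (π₂il : π₂≡ L₁ L₂ il L₂.M₀)
           (π₁ir : π₁≡ R₁ R₂ ir R₁.M₀) (π₂ir : π₂≡ R₁ R₂ ir R₂.M₀)
           (plainˡ₁ : ∀ x → L₁.M₀ x ≤ 1) (plainˡ₂ : ∀ y → L₂.M₀ y ≤ 1)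
           (plainʳ₁ : ∀ x → R₁.M₀ x ≤ 1) (plainʳ₂ : ∀ y → R₂.M₀ y ≤ 1) where

    module Initˡ = InitialLinking {N₁ = L₁} {L₂} {il} π₁il π₂il plainˡ₁ plainˡ₂
    module Initʳ = InitialLinking {N₁ = R₁} {R₂} {ir} π₁ir π₂ir plainʳ₁ plainʳ₂

    module ChoiceStep {l c : Linking C₁ C₂} (lrel : ChoiceLinking 𝓑ˡ 𝓑ʳ il ir l) (c≤l : _≤ᴸ_ C₁ C₂ c l) where
      open ChoiceLinking lrel public

      cˡ : Linking L₁ L₂
      cˡ x y = c (inj₁ x) (inj₁ y)

      cʳ : Linking R₁ R₂
      cʳ x y = c (inj₂ (inj₁ x)) (inj₂ (inj₁ y))

      lᵖ cᵖ : P₁ → P₂ → ℕ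
      lᵖ p q = l (inj₂ (inj₂ p)) (inj₂ (inj₂ q))
      cᵖ p q = c (inj₂ (inj₂ p)) (inj₂ (inj₂ q))

      ProductsAfter : (L₁.S → ℕ) → (L₂.S → ℕ) → (R₁.S → ℕ) → (R₂.S → ℕ) → Set
      ProductsAfter mˡ₁′ mˡ₂′ mʳ₁′ mʳ₂′ =
        (∀ p q → lᵖ p q ∸ cᵖ p q + 0 ≡ ((mˡ₁′ ◃ il) ⊗ (mʳ₁′ ◃ ir)) p q) ×
        (∀ p q → lᵖ p q ∸ cᵖ p q + 0 ≡ ((il ▹ mˡ₂′) ⊗ (ir ▹ mʳ₂′)) p q)

      cˡ≤ : _≤ᴸ_ L₁ L₂ cˡ (λ x y → l (inj₁ x) (inj₁ y))
      cˡ≤ x y = c≤l _ _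

      cʳ≤ : _≤ᴸ_ R₁ R₂ cʳ (λ x y → l (inj₂ (inj₁ x)) (inj₂ (inj₁ y)))
      cʳ≤ x y = c≤l _ _

      c-offˡ₁ : ∀ x y → c (inj₁ x) (inj₂ y) ≡ 0
      c-offˡ₁ x y = ≤-≡0 (c≤l _ _) (offˡ₁ x y)

      c-offˡ₂ : ∀ x y → c (inj₂ x) (inj₁ y) ≡ 0
      c-offˡ₂ x y = ≤-≡0 (c≤l _ _) (offˡ₂ x y)

      c-offʳ₁ : ∀ x q → c (inj₂ (inj₁ x)) (inj₂ (inj₂ q)) ≡ 0
      c-offʳ₁ x q = ≤-≡0 (c≤l _ _) (offʳ₁ x q)

      c-offʳ₂ : ∀ p y → c (inj₂ (inj₂ p)) (inj₂ (inj₁ y)) ≡ 0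
      c-offʳ₂ p y = ≤-≡0 (c≤l _ _) (offʳ₂ p y)

      rowˡ : ∀ {x n} → HasSum (c (inj₁ x)) n → HasSum (cˡ x) n
      rowˡ {x} h = hasSum-inj₁⁻ h (c-offˡ₁ x)

      rowʳ : ∀ {x n} → HasSum (c (inj₂ (inj₁ x))) n → HasSum (cʳ x) n
      rowʳ {x} h = hasSum-inj₁⁻ (hasSum-inj₂⁻ h (c-offˡ₂ (inj₁ x))) (c-offʳ₁ x)

      l-row : ∀ p → HasSum (l (inj₂ (inj₂ p))) (mˡ₁ (placeˡ₁ p) * mʳ₁ (placeʳ₁ p))
      l-row p = hasSum-inj₂ (offˡ₂ (inj₂ p)) (hasSum-inj₂ (offʳ₂ p)
        (hasSum-cong (λ q → sym (product₁ p q))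
          (subst (HasSum _) (cong₂ _*_ (marked-factor (mˡ₁ (placeˡ₁ p)) (placeˡ-marked {X = L₁} {R₁} plainˡ₁ p))
                                       (marked-factor (mʳ₁ (placeʳ₁ p)) (placeʳ-marked {X = L₁} {R₁} plainʳ₁ p)))
            (hasSum-ChoicePlace {X = L₂} {R₂} (hasSum-*ˡ (mˡ₁ (placeˡ₁ p)) (π₁il (placeˡ₁ p)))
                                              (hasSum-*ˡ (mʳ₁ (placeʳ₁ p)) (π₁ir (placeʳ₁ p)))
              (λ y ne → ≢0-≤ (*-≢0ʳ (mˡ₁ (placeˡ₁ p)) ne) (hasSum⇒≤ (π₂il y) _))
              (λ y ne → ≢0-≤ (*-≢0ʳ (mʳ₁ (placeʳ₁ p)) ne) (hasSum⇒≤ (π₂ir y) _))))))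
        where
        marked-factor : ∀ m {M} → M ≡ 1 → m * M ≡ m
        marked-factor m refl = *-identityʳ m

      l-row≤1 : ∀ p → mˡ₁ (placeˡ₁ p) * mʳ₁ (placeʳ₁ p) ≤ 1
      l-row≤1 p = *-mono-≤ (Reserved.m₁≤1 left _) (Reserved.m₁≤1 right _)

      c-row-part : ∀ p {k} → HasSum (c (inj₂ (inj₂ p))) k → k ≤ 1 →
                   ∀ y → c (inj₂ (inj₂ p)) y ≡ k * l (inj₂ (inj₂ p)) y
      c-row-part p h k≤1 = hasSum-≤1-part (c≤l _) h (l-row p) k≤1 (l-row≤1 p)

      c-row-flags : ∀ p → HasSum (c (inj₂ (inj₂ p))) 1 → mˡ₁ (placeˡ₁ p) ≡ 1 × mʳ₁ (placeʳ₁ p) ≡ 1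
      c-row-flags p h = m*n≡1⇒m≡1 _ _ flags≡1 , m*n≡1⇒n≡1 (mˡ₁ (placeˡ₁ p)) _ flags≡1
        where
        flags≡1 : mˡ₁ (placeˡ₁ p) * mʳ₁ (placeʳ₁ p) ≡ 1
        flags≡1 = ≤-antisym (l-row≤1 p) (hasSum-mono (c≤l _) h (l-row p))

      ChoiceLinking-update : ∀ {c̄ˡ c̄ʳ mˡ₁′ mˡ₂′ mʳ₁′ mʳ₂′} →
        Reserved L₁ L₂ il 𝓑ˡ mˡ₁′ mˡ₂′ (update L₁ L₂ (λ x y → l (inj₁ x) (inj₁ y)) cˡ c̄ˡ) →
        Reserved R₁ R₂ ir 𝓑ʳ mʳ₁′ mʳ₂′ (update R₁ R₂ (λ x y → l (inj₂ (inj₁ x)) (inj₂ (inj₁ y))) cʳ c̄ʳ) →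
        ProductsAfter mˡ₁′ mˡ₂′ mʳ₁′ mʳ₂′ →
        ChoiceLinking 𝓑ˡ 𝓑ʳ il ir (update C₁ C₂ l c (c̄ˡ ⊕ (c̄ʳ ⊕ 0ᴹ)))
      ChoiceLinking-update left′ right′ (product₁′ , product₂′) =
        choiceLinking _ _ _ _ left′ right′ product₁′ product₂′
          (λ x y → ∸-+0-≡0 (c _ _) (offˡ₁ x y)) (λ x y → ∸-+0-≡0 (c _ _) (offˡ₂ x y))
          (λ x q → ∸-+0-≡0 (c _ _) (offʳ₁ x q)) (λ p y → ∸-+0-≡0 (c _ _) (offʳ₂ p y))

      products-idle : (∀ p y → c (inj₂ (inj₂ p)) y ≡ 0) → ProductsAfter mˡ₁ mˡ₂ mʳ₁ mʳ₂
      products-idle c≡0 = (λ p q → trans (unchanged p q) (product₁ p q)) , (λ p q → trans (unchanged p q) (product₂ p q))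
        where
        unchanged : ∀ p q → lᵖ p q ∸ cᵖ p q + 0 ≡ lᵖ p q
        unchanged p q rewrite c≡0 p (inj₂ (inj₂ q)) = +-identityʳ _

      module Consumedˡ {K : L₁.S → ℕ} (K≤M : ∀ x → K x ≤ L₁.M₀ x) (markedʳ : Σ R₁.S λ x → R₁.M₀ x ≢ 0)
                       (c-row : ∀ p → HasSum (c (inj₂ (inj₂ p))) (K (placeˡ₁ p) * R₁.M₀ (placeʳ₁ p))) where

        K≤1 : ∀ x → K x ≤ 1
        K≤1 x = ≤-trans (K≤M x) (plainˡ₁ x)

        c-row′ : ∀ p → HasSum (c (inj₂ (inj₂ p))) (K (placeˡ₁ p))
        c-row′ p = subst (HasSum _) (trans (cong (K (placeˡ₁ p) *_) (placeʳ-marked {X = L₁} {R₁} plainʳ₁ p)) (*-identityʳ _))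
                         (c-row p)

        c≡K*l : ∀ p y → c (inj₂ (inj₂ p)) y ≡ K (placeˡ₁ p) * l (inj₂ (inj₂ p)) y
        c≡K*l p = c-row-part p (c-row′ p) (K≤1 _)

        K⇒flags : ∀ p → K (placeˡ₁ p) ≡ 1 → mˡ₁ (placeˡ₁ p) ≡ 1 × mʳ₁ (placeʳ₁ p) ≡ 1
        K⇒flags p K≡1 = c-row-flags p (subst (HasSum _) K≡1 (c-row′ p))

        -- Uses that R₁ is initially marked: a choice place over x shows the flag of x.
        K≤mˡ₁ : ∀ x → K x ≤ mˡ₁ x
        K≤mˡ₁ x with ≤1⇒≡0⊎≡1 (K≤1 x) | K≤M x
        ... | inj₁ K≡0 | _    = subst (_≤ _) (sym K≡0) z≤n
        ... | inj₂ K≡1 | K≤Mx = ≤-reflexive (trans K≡1 (sym (proj₁ (K⇒flags p K≡1))))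
          where p = (x , proj₁ markedʳ) , subst (_≤ _) K≡1 K≤Mx , ≢0-≤ (proj₂ markedʳ) ≤-refl

        c-col : ∀ q → HasSum (λ p → cᵖ p q) (Initˡ.push K (placeˡ₂ q) * R₂.M₀ (placeʳ₂ q))
        c-col q = hasSum-cong (λ p → sym (c-product p))
          (hasSum-ChoicePlace {X = L₁} {R₁} (Initˡ.hasSum-push K (placeˡ₂ q)) (π₂ir (placeʳ₂ q))
            (λ x ne → ≢0-≤ (*-≢0ˡ ne) (K≤M x)) (λ x ne → ≢0-≤ ne (hasSum⇒≤ (π₁ir x) _)))
          where
          c-product : ∀ p → cᵖ p q ≡ (K (placeˡ₁ p) * il (placeˡ₁ p) (placeˡ₂ q)) * ir (placeʳ₁ p) (placeʳ₂ q)
          c-product p = trans (c≡K*l p _) (trans (cong (K (placeˡ₁ p) *_) (product₁ p q)) (*-flagsˡ _ _ (K≤1 _) (K⇒flags p)))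

        products-consumed : ProductsAfter (λ x → mˡ₁ x ∸ K x) (λ y → mˡ₂ y ∸ Initˡ.push K y) mʳ₁ mʳ₂
        products-consumed = consumed₁ , λ p q → trans (consumed₁ p q)
          (sym (cong₂ _*_ (Initˡ.consistent-∸ {K = K} left K≤1 _ _) (Reserved.consistent right _ _)))
          where
          consumed₁ : ∀ p q → lᵖ p q ∸ cᵖ p q + 0 ≡ (((λ x → mˡ₁ x ∸ K x) ◃ il) ⊗ (mʳ₁ ◃ ir)) p q
          consumed₁ p q = trans (cong (λ z → lᵖ p q ∸ z + 0) (c≡K*l p _))
            (consume-factorˡ (K (placeˡ₁ p)) (K≤1 _) (λ K≡1 → proj₁ (K⇒flags p K≡1)) (product₁ p q))

      module Consumedʳ {K : R₁.S → ℕ} (K≤M : ∀ x → K x ≤ R₁.M₀ x) (markedˡ : Σ L₁.S λ x → L₁.M₀ x ≢ 0)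
                       (c-row : ∀ p → HasSum (c (inj₂ (inj₂ p))) (L₁.M₀ (placeˡ₁ p) * K (placeʳ₁ p))) where

        K≤1 : ∀ x → K x ≤ 1
        K≤1 x = ≤-trans (K≤M x) (plainʳ₁ x)

        c-row′ : ∀ p → HasSum (c (inj₂ (inj₂ p))) (K (placeʳ₁ p))
        c-row′ p = subst (HasSum _) (trans (cong (_* K (placeʳ₁ p)) (placeˡ-marked {X = L₁} {R₁} plainˡ₁ p)) (*-identityˡ _))
                         (c-row p)

        c≡K*l : ∀ p y → c (inj₂ (inj₂ p)) y ≡ K (placeʳ₁ p) * l (inj₂ (inj₂ p)) y
        c≡K*l p = c-row-part p (c-row′ p) (K≤1 _)

        K⇒flags : ∀ p → K (placeʳ₁ p) ≡ 1 → mˡ₁ (placeˡ₁ p) ≡ 1 × mʳ₁ (placeʳ₁ p) ≡ 1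
        K⇒flags p K≡1 = c-row-flags p (subst (HasSum _) K≡1 (c-row′ p))

        K≤mʳ₁ : ∀ x → K x ≤ mʳ₁ x
        K≤mʳ₁ x with ≤1⇒≡0⊎≡1 (K≤1 x) | K≤M x
        ... | inj₁ K≡0 | _    = subst (_≤ _) (sym K≡0) z≤n
        ... | inj₂ K≡1 | K≤Mx = ≤-reflexive (trans K≡1 (sym (proj₂ (K⇒flags p K≡1))))
          where p = (proj₁ markedˡ , x) , ≢0-≤ (proj₂ markedˡ) ≤-refl , subst (_≤ _) K≡1 K≤Mx

        c-col : ∀ q → HasSum (λ p → cᵖ p q) (L₂.M₀ (placeˡ₂ q) * Initʳ.push K (placeʳ₂ q))
        c-col q = hasSum-cong (λ p → sym (c-product p))
          (hasSum-ChoicePlace {X = L₁} {R₁} (π₂il (placeˡ₂ q)) (Initʳ.hasSum-push K (placeʳ₂ q))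
            (λ x ne → ≢0-≤ ne (hasSum⇒≤ (π₁il x) _)) (λ x ne → ≢0-≤ (*-≢0ˡ ne) (K≤M x)))
          where
          c-product : ∀ p → cᵖ p q ≡ il (placeˡ₁ p) (placeˡ₂ q) * (K (placeʳ₁ p) * ir (placeʳ₁ p) (placeʳ₂ q))
          c-product p = trans (c≡K*l p _) (trans (cong (K (placeʳ₁ p) *_) (product₁ p q)) (*-flagsʳ _ _ (K≤1 _) (K⇒flags p)))

        products-consumed : ProductsAfter mˡ₁ mˡ₂ (λ x → mʳ₁ x ∸ K x) (λ y → mʳ₂ y ∸ Initʳ.push K y)
        products-consumed = consumed₁ , λ p q → trans (consumed₁ p q)
          (sym (cong₂ _*_ (Reserved.consistent left _ _) (Initʳ.consistent-∸ {K = K} right K≤1 _ _)))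
          where
          consumed₁ : ∀ p q → lᵖ p q ∸ cᵖ p q + 0 ≡ ((mˡ₁ ◃ il) ⊗ ((λ x → mʳ₁ x ∸ K x) ◃ ir)) p q
          consumed₁ p q = trans (cong (λ z → lᵖ p q ∸ z + 0) (c≡K*l p _))
            (consume-factorʳ {X = mˡ₁ (placeˡ₁ p) * il (placeˡ₁ p) (placeˡ₂ q)} (K (placeʳ₁ p)) (K≤1 _)
               (λ K≡1 → proj₂ (K⇒flags p K≡1)) (product₁ p q))

    module _ (simˡ : Simulation L₁ L₂ 𝓑ˡ) (simʳ : Simulation R₁ R₂ 𝓑ʳ)
             (markedˡ : Σ L₁.S λ x → L₁.M₀ x ≢ 0) (markedʳ : Σ R₁.S λ x → R₁.M₀ x ≢ 0) where

      choice-Simulation : Simulation C₁ C₂ (ChoiceLinking 𝓑ˡ 𝓑ʳ il ir)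
      choice-Simulation l c (inj₁ t) lrel c≤l πc =
        response (inj₁ S.t₂) S.ℓ≡ π₂c (S.c̄ ⊕ (0ᴹ ⊕ 0ᴹ))
          (λ { (inj₁ x) → ⊕-row₁ (S.π₁c̄ x) ; (inj₂ x) → ⊕-row₂ (hasSum-0 (0ᴹ⊕0ᴹ x)) })
          (λ { (inj₁ y) → ⊕-col₁ (S.π₂c̄ y) ; (inj₂ y) → ⊕-col₂ (hasSum-0 λ x → 0ᴹ⊕0ᴹ x y) })
          (ChoiceLinking-update S.next (Reserved-idle R₁ R₂ ir (λ x y → idle (inj₁ x) _) right)
             (products-idle λ p → idle (inj₂ p)))
        where
        open ChoiceStep lrel c≤l
        idle : ∀ x y → c (inj₂ x) y ≡ 0
        idle x = hasSum-0⇒≡0 (πc (inj₂ x))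
        module S = Step (Initˡ.plain-step simˡ left cˡ≤ (λ x → rowˡ (πc (inj₁ x))))
        π₂c : π₂≡ C₁ C₂ c (PNet.pre C₂ (inj₁ S.t₂))
        π₂c (inj₁ y) = hasSum-inj₁ (S.π₂cb y) (λ x → c-offˡ₂ x y)
        π₂c (inj₂ y) = hasSum-0 λ { (inj₁ x) → c-offˡ₁ x y ; (inj₂ x) → idle x (inj₂ y) }
      choice-Simulation l c (inj₂ (inj₁ t)) lrel c≤l πc =
        response (inj₂ (inj₁ S.t₂)) S.ℓ≡ π₂c (0ᴹ ⊕ (S.c̄ ⊕ 0ᴹ))
          (λ { (inj₁ x) → ⊕-row₁ (hasSum-0 λ _ → refl)
             ; (inj₂ (inj₁ x)) → ⊕-row₂ (⊕-row₁ (S.π₁c̄ x))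
             ; (inj₂ (inj₂ p)) → ⊕-row₂ (⊕-row₂ (hasSum-0 λ _ → refl)) })
          (λ { (inj₁ y) → ⊕-col₁ (hasSum-0 λ _ → refl)
             ; (inj₂ (inj₁ y)) → ⊕-col₂ (⊕-col₁ (S.π₂c̄ y))
             ; (inj₂ (inj₂ q)) → ⊕-col₂ (⊕-col₂ (hasSum-0 λ _ → refl)) })
          (ChoiceLinking-update (Reserved-idle L₁ L₂ il (λ x y → idleˡ x _) left) S.next
             (products-idle idleᶜ))
        where
        open ChoiceStep lrel c≤l
        idleˡ : ∀ x y → c (inj₁ x) y ≡ 0
        idleˡ x = hasSum-0⇒≡0 (πc (inj₁ x))
        idleᶜ : ∀ p y → c (inj₂ (inj₂ p)) y ≡ 0
        idleᶜ p = hasSum-0⇒≡0 (πc (inj₂ (inj₂ p)))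
        module S = Step (Initʳ.plain-step simʳ right cʳ≤ (λ x → rowʳ (πc (inj₂ (inj₁ x)))))
        π₂c : π₂≡ C₁ C₂ c (PNet.pre C₂ (inj₂ (inj₁ S.t₂)))
        π₂c (inj₁ y)        = hasSum-0 λ { (inj₁ x) → idleˡ x _ ; (inj₂ x) → c-offˡ₂ x y }
        π₂c (inj₂ (inj₁ y)) = hasSum-inj₂ (λ x → idleˡ x _) (hasSum-inj₁ (S.π₂cb y) (λ p → c-offʳ₂ p y))
        π₂c (inj₂ (inj₂ q)) =
          hasSum-0 λ { (inj₁ x) → idleˡ x _ ; (inj₂ (inj₁ x)) → c-offʳ₁ x q ; (inj₂ (inj₂ p)) → idleᶜ p _ }
      choice-Simulation l c (inj₂ (inj₂ (inj₁ (t , K , K≤pre⊓M , x₀ , Kx₀≢0)))) lrel c≤l πc =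
        response (inj₂ (inj₂ (inj₁ (S.t₂ , Initˡ.push K , proj₂ K-stepˡ , Initˡ.push-nonzero {K = K} Kx₀≢0 (K≤M x₀)))))
          S.ℓ≡ π₂c (S.c̄ ⊕ (0ᴹ ⊕ 0ᴹ))
          (λ { (inj₁ x) → ⊕-row₁ (S.π₁c̄ x) ; (inj₂ x) → ⊕-row₂ (hasSum-0 (0ᴹ⊕0ᴹ x)) })
          (λ { (inj₁ y) → ⊕-col₁ (S.π₂c̄ y) ; (inj₂ y) → ⊕-col₂ (hasSum-0 λ x → 0ᴹ⊕0ᴹ x y) })
          (ChoiceLinking-update S.next (Reserved-idle R₁ R₂ ir (λ x y → idleʳ x _) right)
             products-consumed)
        where
        open ChoiceStep lrel c≤l
        K≤M : ∀ x → K x ≤ L₁.M₀ x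
        K≤M x = ≤-trans (K≤pre⊓M x) (m⊓n≤n _ _)
        open Consumedˡ K≤M markedʳ (λ p → πc (inj₂ (inj₂ p)))
        idleʳ : ∀ x y → c (inj₂ (inj₁ x)) y ≡ 0
        idleʳ x = hasSum-0⇒≡0 (πc (inj₂ (inj₁ x)))
        K-stepˡ = Initˡ.K-step simˡ left cˡ≤ K≤pre⊓M K≤mˡ₁ (λ x → rowˡ (πc (inj₁ x)))
        module S = Step (proj₁ K-stepˡ)
        π₂c : π₂≡ C₁ C₂ c (PNet.pre C₂ (inj₂ (inj₂ (inj₁ (S.t₂ , Initˡ.push K , _ , _)))))
        π₂c (inj₁ y)        = hasSum-inj₁ (S.π₂cb y) (λ x → c-offˡ₂ x y)
        π₂c (inj₂ (inj₁ y)) =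
          hasSum-0 λ { (inj₁ x) → c-offˡ₁ x _ ; (inj₂ (inj₁ x)) → idleʳ x _ ; (inj₂ (inj₂ p)) → c-offʳ₂ p y }
        π₂c (inj₂ (inj₂ q)) = hasSum-inj₂ (λ x → c-offˡ₁ x _) (hasSum-inj₂ (λ x → idleʳ x _) (c-col q))
      choice-Simulation l c (inj₂ (inj₂ (inj₂ (t , K , K≤pre⊓M , x₀ , Kx₀≢0)))) lrel c≤l πc =
        response (inj₂ (inj₂ (inj₂ (S.t₂ , Initʳ.push K , proj₂ K-stepʳ , Initʳ.push-nonzero {K = K} Kx₀≢0 (K≤M x₀)))))
          S.ℓ≡ π₂c (0ᴹ ⊕ (S.c̄ ⊕ 0ᴹ))
          (λ { (inj₁ x) → ⊕-row₁ (hasSum-0 λ _ → refl)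
             ; (inj₂ (inj₁ x)) → ⊕-row₂ (⊕-row₁ (S.π₁c̄ x))
             ; (inj₂ (inj₂ p)) → ⊕-row₂ (⊕-row₂ (hasSum-0 λ _ → refl)) })
          (λ { (inj₁ y) → ⊕-col₁ (hasSum-0 λ _ → refl)
             ; (inj₂ (inj₁ y)) → ⊕-col₂ (⊕-col₁ (S.π₂c̄ y))
             ; (inj₂ (inj₂ q)) → ⊕-col₂ (⊕-col₂ (hasSum-0 λ _ → refl)) })
          (ChoiceLinking-update (Reserved-idle L₁ L₂ il (λ x y → idleˡ x _) left) S.next
             products-consumed)
        where
        open ChoiceStep lrel c≤l
        K≤M : ∀ x → K x ≤ R₁.M₀ x
        K≤M x = ≤-trans (K≤pre⊓M x) (m⊓n≤n _ _)
        open Consumedʳ K≤M markedˡ (λ p → πc (inj₂ (inj₂ p)))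
        idleˡ : ∀ x y → c (inj₁ x) y ≡ 0
        idleˡ x = hasSum-0⇒≡0 (πc (inj₁ x))
        K-stepʳ = Initʳ.K-step simʳ right cʳ≤ K≤pre⊓M K≤mʳ₁ (λ x → rowʳ (πc (inj₂ (inj₁ x))))
        module S = Step (proj₁ K-stepʳ)
        π₂c : π₂≡ C₁ C₂ c (PNet.pre C₂ (inj₂ (inj₂ (inj₂ (S.t₂ , Initʳ.push K , _ , _)))))
        π₂c (inj₁ y)        = hasSum-0 λ { (inj₁ x) → idleˡ x _ ; (inj₂ x) → c-offˡ₂ x y }
        π₂c (inj₂ (inj₁ y)) = hasSum-inj₂ (λ x → idleˡ x _) (hasSum-inj₁ (S.π₂cb y) (λ p → c-offʳ₂ p y))
        π₂c (inj₂ (inj₂ q)) = hasSum-inj₂ (λ x → idleˡ x _) (hasSum-inj₂ (λ x → c-offʳ₁ x q) (c-col q))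

module _ {Act : Set} {L₁ L₂ R₁ R₂ : PNet Act} where

  ChoiceLinking-flip : ∀ {𝓑ˡ 𝓑ʳ il ir l} → ChoiceLinking L₁ L₂ R₁ R₂ 𝓑ˡ 𝓑ʳ il ir l →
    ChoiceLinking L₂ L₁ R₂ R₁ (converse L₁ L₂ 𝓑ˡ) (converse R₁ R₂ 𝓑ʳ) (flipᴸ L₁ L₂ il) (flipᴸ R₁ R₂ ir)
                  (flipᴸ (choiceᴺ L₁ R₁) (choiceᴺ L₂ R₂) l)
  ChoiceLinking-flip (choiceLinking mˡ₁ mˡ₂ mʳ₁ mʳ₂ left right product₁ product₂ offˡ₁ offˡ₂ offʳ₁ offʳ₂) =
    choiceLinking mˡ₂ mˡ₁ mʳ₂ mʳ₁ (Reserved-flip left) (Reserved-flip right)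
      (λ q p → product₂ p q) (λ q p → product₁ p q)
      (λ y x → offˡ₂ x y) (λ y x → offˡ₁ x y) (λ y p → offʳ₂ p y) (λ q x → offʳ₁ x q)

choice-↔sp : ∀ {Act} (L₁ L₂ R₁ R₂ : PNet Act) →
  PlainNonemptyInit L₁ → PlainNonemptyInit L₂ → PlainNonemptyInit R₁ → PlainNonemptyInit R₂ →
  _↔sp_ L₁ L₂ → _↔sp_ R₁ R₂ → _↔sp_ (choiceᴺ L₁ R₁) (choiceᴺ L₂ R₂)
choice-↔sp L₁ L₂ R₁ R₂ (plainˡ₁ , markedˡ₁) (plainˡ₂ , markedˡ₂) (plainʳ₁ , markedʳ₁) (plainʳ₂ , markedʳ₂)
           (A⇔ˡ , 𝓑ˡ , bisimˡ , il , il∈ , π₁il , π₂il) (A⇔ʳ , 𝓑ʳ , bisimʳ , ir , ir∈ , π₁ir , π₂ir) =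
  (λ a → mk⇔ (⊎-map (Equivalence.to (A⇔ˡ a)) (Equivalence.to (A⇔ʳ a)))
             (⊎-map (Equivalence.from (A⇔ˡ a)) (Equivalence.from (A⇔ʳ a)))) ,
  ChoiceLinking L₁ L₂ R₁ R₂ 𝓑ˡ 𝓑ʳ il ir ,
  Simulations⇒IsSPBisimulation {N₁ = choiceᴺ L₁ R₁} {N₂ = choiceᴺ L₂ R₂}
    (choice-Simulation L₁ L₂ R₁ R₂ π₁il π₂il π₁ir π₂ir plainˡ₁ plainˡ₂ plainʳ₁ plainʳ₂
      (IsSPBisimulation⇒Simulation bisimˡ) (IsSPBisimulation⇒Simulation bisimʳ) markedˡ₁ markedʳ₁)
    (choice-Simulation L₂ L₁ R₂ R₁ π₂il π₁il π₂ir π₁ir plainˡ₂ plainˡ₁ plainʳ₂ plainʳ₁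
      (IsSPBisimulation⇒converse-Simulation {N₁ = L₁} {N₂ = L₂} bisimˡ)
      (IsSPBisimulation⇒converse-Simulation {N₁ = R₁} {N₂ = R₂} bisimʳ) markedˡ₂ markedʳ₂)
    (ChoiceLinking-flip {L₁ = L₁} {L₂} {R₁} {R₂}) (ChoiceLinking-flip {L₁ = L₂} {L₁} {R₂} {R₁}) ,
  0ᴹ ⊕ (0ᴹ ⊕ _⊗_ L₁ L₂ R₁ R₂ ((λ _ → 1) ◃ il) ((λ _ → 1) ◃ ir)) ,
  choiceLinking (λ _ → 1) (λ _ → 1) (λ _ → 1) (λ _ → 1)
    (reserved il il∈ (λ _ → ≤-refl) (λ _ → ≤-refl) (λ x y → *-identityˡ (il x y)) (λ x y → *-identityˡ (il x y)))
    (reserved ir ir∈ (λ _ → ≤-refl) (λ _ → ≤-refl) (λ x y → *-identityˡ (ir x y)) (λ x y → *-identityˡ (ir x y)))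
    (λ _ _ → refl) (λ _ _ → refl) (λ _ _ → refl) (λ _ _ → refl) (λ _ _ → refl) (λ _ _ → refl) ,
  (λ { (inj₁ x) → ⊕-row₁ (hasSum-0 λ _ → refl) ; (inj₂ (inj₁ x)) → ⊕-row₂ (⊕-row₁ (hasSum-0 λ _ → refl))
     ; (inj₂ (inj₂ p)) → ⊕-row₂ (⊕-row₂ (subst (HasSum _)
         (unit-product (placeˡ-marked {X = L₁} {R₁} plainˡ₁ p) (placeʳ-marked {X = L₁} {R₁} plainʳ₁ p))
         (hasSum-ChoicePlace {X = L₂} {R₂} (hasSum-*ˡ 1 (π₁il _)) (hasSum-*ˡ 1 (π₁ir _))
           (λ y ne → ≢0-≤ (*-≢0ʳ 1 ne) (hasSum⇒≤ (π₂il y) _))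
           (λ y ne → ≢0-≤ (*-≢0ʳ 1 ne) (hasSum⇒≤ (π₂ir y) _))))) }) ,
  (λ { (inj₁ y) → ⊕-col₁ (hasSum-0 λ _ → refl) ; (inj₂ (inj₁ y)) → ⊕-col₂ (⊕-col₁ (hasSum-0 λ _ → refl))
     ; (inj₂ (inj₂ q)) → ⊕-col₂ (⊕-col₂ (subst (HasSum _)
         (unit-product (placeˡ-marked {X = L₂} {R₂} plainˡ₂ q) (placeʳ-marked {X = L₂} {R₂} plainʳ₂ q))
         (hasSum-ChoicePlace {X = L₁} {R₁} (hasSum-*ˡ 1 (π₂il _)) (hasSum-*ˡ 1 (π₂ir _))
           (λ x ne → ≢0-≤ (*-≢0ʳ 1 ne) (hasSum⇒≤ (π₁il x) _))
           (λ x ne → ≢0-≤ (*-≢0ʳ 1 ne) (hasSum⇒≤ (π₁ir x) _))))) })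
  where
  unit-product : ∀ {m n} → m ≡ 1 → n ≡ 1 → 1 * m * (1 * n) ≡ 1
  unit-product refl refl = refl

theorem2 : (Act : Set) → InfiniteSet Act →
    (N₁ N₂ Nl₁ Nl₂ Nr₁ Nr₂ : PNet Act) → (a : Act) → (R : Act → Act → Set) →
    BoundedParallelism N₁ → BoundedParallelism N₂ →
    BoundedParallelism Nl₁ → BoundedParallelism Nl₂ →
    BoundedParallelism Nr₁ → BoundedParallelism Nr₂ →
    ((_↔sp_ N₁ N₂ →
        _↔sp_ (prefixᴺ a N₁) (prefixᴺ a N₂) ×
        _↔sp_ (relabelᴺ R N₁) (relabelᴺ R N₂))
    ×
     (_↔sp_ Nl₁ Nl₂ → _↔sp_ Nr₁ Nr₂ →
        _↔sp_ (parᴺ Nl₁ Nr₁) (parᴺ Nl₂ Nr₂) ×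
        (PlainNonemptyInit Nl₁ → PlainNonemptyInit Nl₂ →
         PlainNonemptyInit Nr₁ → PlainNonemptyInit Nr₂ →
           _↔sp_ (choiceᴺ Nl₁ Nr₁) (choiceᴺ Nl₂ Nr₂))))
theorem2 Act _ N₁ N₂ Nl₁ Nl₂ Nr₁ Nr₂ a R _ _ _ _ _ _ =
  (λ N₁↔N₂ → prefix-↔sp a N₁ N₂ N₁↔N₂ , relabel-↔sp R N₁ N₂ N₁↔N₂) ,
  (λ Nl₁↔Nl₂ Nr₁↔Nr₂ →
     par-↔sp Nl₁ Nl₂ Nr₁ Nr₂ Nl₁↔Nl₂ Nr₁↔Nr₂ ,
     λ initˡ₁ initˡ₂ initʳ₁ initʳ₂ →
       choice-↔sp Nl₁ Nl₂ Nr₁ Nr₂ initˡ₁ initˡ₂ initʳ₁ initʳ₂ Nl₁↔Nl₂ Nr₁↔Nr₂)
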